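{- Let $n\ge 3$ and $\lambda=(1^{a_1},2^{a_2},\ldots,n^{a_n})\vdash n$. For any $i<j$ in $[n]$, \[\Pr_{\lambda}[I_{i,j} =1]=\frac{1}{2}+ \frac{a_2}{n(n-1)}-\frac{a_1(a_1-1)}{2n(n-1)} + (j-i-1)\cdot \frac{n-n a_1-a_1+a_1^2-2a_2}{n(n-1)(n-2)}.\]
   Context: $S_n$ is the symmetric group on $[n]$; $C_\lambda$ is the conjugacy class of permutations of cycle type $\lambda$ and $\Pr_\lambda$ is the uniform probability measure on $C_\lambda$. The notation $\lambda=(1^{a_1},\ldots,n^{a_n})$ means $\lambda$ has exactly $a_r$ parts equal to $r$. $I_{i,j}(\omega)=1$ if $\omega(i)>\omega(j)$ and $0$ otherwise. -}

module Defs where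

open import Data.Bool using (Bool; true; false; _∧_; if_then_else_)
open import Data.Nat using (ℕ; zero; suc; _+_; _*_; _∸_; _<ᵇ_; _≡ᵇ_)
open import Data.Fin using (Fin; toℕ; _≟_)
open import Data.Vec using (Vec; []; _∷_; lookup)
open import Data.List using (List; []; _∷_; _++_; map; concatMap; filter; length; allFin; upTo)
open import Data.Integer using (ℤ; +_)
open import Data.Rational using (ℚ; 0ℚ; _/_)
open import Relation.Nullary.Decidable using (⌊_⌋)
open import Relation.Unary using (Decidable)
open import Data.Bool using (T?)

all : ∀ {A : Set} → (A → Bool) → List A → Bool
all p []       = true
all p (x ∷ xs) = p x ∧ all p xs

allVecs : (n k : ℕ) → List (Vec (Fin n) k)
allVecs n zero    = [] ∷ []
allVecs n (suc k) = concatMap (λ x → map (x ∷_) (allVecs n k)) (allFin n)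

app : ∀ {n} → Vec (Fin n) n → Fin n → Fin n
app = lookup

-- ω is injective (hence a permutation of the finite set [n]).
isPerm : ∀ {n} → Vec (Fin n) n → Bool
isPerm {n} ω = all (λ x → all (λ y → ⌊ x ≟ y ⌋ ∨' not' ⌊ app ω x ≟ app ω y ⌋) (allFin n)) (allFin n)
  where
  not' : Bool → Bool
  not' true = false
  not' false = true
  _∨'_ : Bool → Bool → Bool
  true ∨' _ = true
  false ∨' b = b

Sym : (n : ℕ) → List (Vec (Fin n) n)
Sym n = filter (λ ω → T? (isPerm ω)) (allVecs n n)

iter : ∀ {n} → Vec (Fin n) n → ℕ → Fin n → Fin n
iter ω zero    x = x
iter ω (suc k) x = app ω (iter ω k x)

-- least k ≥ 1 (searched among k, k+1, ..., with given fuel) with ω^k x = x; 0 if none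
firstReturn : ∀ {n} → Vec (Fin n) n → Fin n → ℕ → ℕ → ℕ
firstReturn ω x k zero       = 0
firstReturn ω x k (suc fuel) =
  if ⌊ iter ω k x ≟ x ⌋ then k else firstReturn ω x (suc k) fuel

-- length of the cycle of ω containing x (least k ≥ 1 with ω^k x = x; k ≤ n for a permutation)
cycLen : ∀ {n} → Vec (Fin n) n → Fin n → ℕ
cycLen {n} ω x = firstReturn ω x 1 n

count : ∀ {A : Set} → (A → Bool) → List A → ℕ
count p xs = length (filter (λ x → T? (p x)) xs)

-- number of cycles of ω of length r  (= #{x : cycle of x has length r} / r);
-- stated divisions-free: ω has exactly a_r cycles of length r iff #{x : cycLen x = r} = r * a_r.
-- ω has cycle type λ = (1^{a 1}, 2^{a 2}, …, n^{a n}):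
hasCycleType : ∀ {n} → (ℕ → ℕ) → Vec (Fin n) n → Bool
hasCycleType {n} a ω =
  all (λ r → count (λ x → cycLen ω x ≡ᵇ suc r) (allFin n) ≡ᵇ suc r * a (suc r)) (upTo n)

Class : (n : ℕ) → (ℕ → ℕ) → List (Vec (Fin n) n)
Class n a = filter (λ ω → T? (hasCycleType a ω)) (Sym n)

weight : ℕ → (ℕ → ℕ) → ℕ
weight zero    a = 0
weight (suc r) a = weight r a + suc r * a (suc r)

I : ∀ {n} → Fin n → Fin n → Vec (Fin n) n → Bool
I i j ω = toℕ (app ω j) <ᵇ toℕ (app ω i)

-- p / d as a rational, with the (unused) convention p / 0 = 0
frac : ℤ → ℕ → ℚ
frac p zero    = 0ℚ
frac p (suc d) = p / suc d

PrI : (n : ℕ) → (ℕ → ℕ) → Fin n → Fin n → ℚ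
PrI n a i j = frac (+ count (I i j) (Class n a)) (length (Class n a))

module Submission where

-- Write T(i,j) = #{ω ∈ C_λ : ω(i) > ω(j)}.  Conjugating by a transposition preserves C_λ, so the number
-- of ω ∈ C_λ taking prescribed values at two points depends only on the pattern of the points involved:
-- fix² (ω p = p, ω r = r), swap² (ω p = r, ω r = p), mapFix³ (ω p = q, ω r = r) and path³ (ω p = r,
-- ω r = q), for distinct p, q, r.  Summing such a count over all ordered pairs or triples of distinct
-- points and regrouping by permutation expresses it through a₁, a₂ and |C_λ|.  For ω and its conjugate
-- by (i i+1), exactly one has an inversion at (i, i+1) unless ω maps {i, i+1} onto itself; hence
-- 2 T(i,i+1) + fix² = |C_λ| + swap².  Conjugating by (j j+1), j > i, gives T(i,j+1) − T(i,j) =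
-- path³ − mapFix³.  Solving, and dividing by |C_λ| (nonzero, since disjoint cycles of the prescribed
-- lengths form an element of C_λ), yields the formula.

open import Algebra.Definitions using (Involutive)
open import Data.Bool using (Bool; true; false; T; T?; not; _∧_; if_then_else_)
open import Data.Bool.Properties using (¬-not; ⇔→≡)
open import Data.Empty using (⊥-elim)
open import Data.Fin using (Fin; zero; suc; toℕ; fromℕ<; _↑ˡ_; _↑ʳ_; splitAt; join) renaming (_≟_ to _≟ᶠ_; _<_ to _<ᶠ_)
open import Data.Fin.Permutation.Components using (transpose)
open import Data.Fin.Properties using (toℕ-injective; toℕ-fromℕ<; toℕ<n; ↑ˡ-injective; ↑ʳ-injective; splitAt-↑ˡ; splitAt-↑ʳ; join-splitAt; splitAt-join)
open import Data.List using (List; []; _∷_; _++_; map; concatMap; filter; length; replicate; allFin; upTo)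
open import Data.List.Properties using (map-tabulate; length-tabulate)
open import Data.List.Membership.Propositional using (_∈_)
open import Data.List.Membership.Propositional.Properties using (∈-allFin; ∈-upTo⁺; ∈-upTo⁻)
open import Data.List.Relation.Unary.Any using (here; there)
open import Data.Nat using (ℕ; zero; suc; _+_; _*_; _∸_; _≤_; _<_; _<ᵇ_; _≡ᵇ_; z≤n; s≤s; NonZero)
open import Data.Nat.Properties
open import Algebra.Properties.CommutativeSemigroup +-commutativeSemigroup using () renaming (interchange to +-interchange)
open import Algebra.Properties.CommutativeSemigroup *-commutativeSemigroup using () renaming (x∙yz≈y∙xz to x*yz≡y*xz; x∙yz≈z∙xy to x*yz≡z*xy)
open import Data.Nat.GeneralisedArithmetic using (fold; fold-+)
open import Data.Nat.DivMod using (_%_; _mod_; %-distribˡ-+; m%n%n≡m%n; [m+n]%n≡m%n; m<n⇒m%n≡m; m≤n⇒[n∸m]%m≡n%m; m%n<n)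
open import Data.Nat.Tactic.RingSolver using (solve-∀)
open import Data.Product using (Σ; ∃; _×_; _,_; proj₁; proj₂)
open import Data.Sum using (_⊎_; inj₁; inj₂) renaming (map to map⊎)
open import Data.Sum.Properties using (inj₁-injective; inj₂-injective)
open import Data.Vec using (Vec; []; _∷_; lookup; tabulate)
open import Data.Vec.Properties using (lookup∘tabulate; tabulate∘lookup; tabulate-cong) renaming (≡-dec to ≡-decᵛ)
open import Function using (_∘_; id; mk⇔)
open import Relation.Binary.Definitions using (DecidableEquality)
open import Relation.Binary.PropositionalEquality
open import Relation.Nullary using (Dec; yes; no; does)
open import Relation.Nullary.Decidable using (⌊_⌋)
open import Data.Integer as ℤ using (ℤ)
import Data.Integer.Properties as ℤ
open import Data.Integer.Tactic.RingSolver renaming (solve-∀ to solve-∀ᶻ)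
open import Data.Rational as ℚ using (ℚ; toℚᵘ)
import Data.Rational.Properties as ℚ
open import Data.Rational.Unnormalised as ℚᵘ using (mkℚᵘ; *≡*)
import Data.Rational.Unnormalised.Properties as ℚᵘ
open import Defs

private variable
  A B : Set

-- Finite sums and Kronecker deltas

⟦_⟧ : Bool → ℕ
⟦ true ⟧ = 1
⟦ false ⟧ = 0

∑ : List A → (A → ℕ) → ℕ
∑ [] f = 0
∑ (x ∷ xs) f = f x + ∑ xs f

syntax ∑ L (λ x → e) = ∑[ x ∈ L ] e

module _ where
  open ≡-Reasoning

  ∑-cong : ∀ (L : List A) {f g : A → ℕ} → (∀ x → f x ≡ g x) → ∑ L f ≡ ∑ L g
  ∑-cong [] e = refl
  ∑-cong (x ∷ L) e = cong₂ _+_ (e x) (∑-cong L e)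

  ∑-+ : ∀ (L : List A) (f g : A → ℕ) → ∑[ x ∈ L ] (f x + g x) ≡ ∑ L f + ∑ L g
  ∑-+ [] f g = refl
  ∑-+ (x ∷ L) f g = begin
    f x + g x + ∑[ y ∈ L ] (f y + g y) ≡⟨ cong (f x + g x +_) (∑-+ L f g) ⟩
    f x + g x + (∑ L f + ∑ L g)        ≡⟨ +-interchange (f x) (g x) _ _ ⟩
    f x + ∑ L f + (g x + ∑ L g)        ∎

  ∑-*ˡ : ∀ (L : List A) (k : ℕ) (f : A → ℕ) → ∑[ x ∈ L ] (k * f x) ≡ k * ∑ L f
  ∑-*ˡ [] k f = sym (*-zeroʳ k)
  ∑-*ˡ (x ∷ L) k f = trans (cong (k * f x +_) (∑-*ˡ L k f)) (sym (*-distribˡ-+ k (f x) _))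

  ∑-*ʳ : ∀ (L : List A) (k : ℕ) (f : A → ℕ) → ∑[ x ∈ L ] (f x * k) ≡ ∑ L f * k
  ∑-*ʳ L k f = trans (∑-cong L (λ x → *-comm (f x) k)) (trans (∑-*ˡ L k f) (*-comm k _))

  ∑-zero : ∀ (L : List A) → ∑[ _ ∈ L ] 0 ≡ 0
  ∑-zero [] = refl
  ∑-zero (x ∷ L) = ∑-zero L

  ∑-++ : ∀ (L M : List A) (f : A → ℕ) → ∑ (L ++ M) f ≡ ∑ L f + ∑ M f
  ∑-++ [] M f = refl
  ∑-++ (x ∷ L) M f = trans (cong (f x +_) (∑-++ L M f)) (sym (+-assoc (f x) _ _))

  ∑-comm : ∀ (L : List A) (M : List B) (f : A → B → ℕ) →
           ∑[ x ∈ L ] ∑[ y ∈ M ] f x y ≡ ∑[ y ∈ M ] ∑[ x ∈ L ] f x y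
  ∑-comm [] M f = sym (∑-zero M)
  ∑-comm (x ∷ L) M f = trans (cong (∑ M (f x) +_) (∑-comm L M f))
                             (sym (∑-+ M (f x) (λ y → ∑[ x ∈ L ] f x y)))

  ∑-map : ∀ (h : B → A) (L : List B) (f : A → ℕ) → ∑ (map h L) f ≡ ∑[ x ∈ L ] f (h x)
  ∑-map h [] f = refl
  ∑-map h (x ∷ L) f = cong (f (h x) +_) (∑-map h L f)

  ∑-concatMap : ∀ (h : B → List A) (L : List B) (f : A → ℕ) →
                ∑ (concatMap h L) f ≡ ∑[ x ∈ L ] ∑ (h x) f
  ∑-concatMap h [] f = refl
  ∑-concatMap h (x ∷ L) f = trans (∑-++ (h x) (concatMap h L) f) (cong (∑ (h x) f +_) (∑-concatMap h L f))

  ∑-filter : ∀ (q : A → Bool) (L : List A) (f : A → ℕ) →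
             ∑ (filter (λ x → T? (q x)) L) f ≡ ∑[ x ∈ L ] (⟦ q x ⟧ * f x)
  ∑-filter q [] f = refl
  ∑-filter q (x ∷ L) f with q x
  ... | true = cong₂ _+_ (sym (+-identityʳ (f x))) (∑-filter q L f)
  ... | false = ∑-filter q L f

  ∑-replicate : ∀ k (x : A) (f : A → ℕ) → ∑ (replicate k x) f ≡ k * f x
  ∑-replicate zero x f = refl
  ∑-replicate (suc k) x f = cong (f x +_) (∑-replicate k x f)

  ∑-mono-≤ : ∀ (L : List A) {f g : A → ℕ} → (∀ x → f x ≤ g x) → ∑ L f ≤ ∑ L g
  ∑-mono-≤ [] h = z≤n
  ∑-mono-≤ (x ∷ L) h = +-mono-≤ (h x) (∑-mono-≤ L h)

  length≡∑1 : ∀ (L : List A) → length L ≡ ∑[ _ ∈ L ] 1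
  length≡∑1 [] = refl
  length≡∑1 (x ∷ L) = cong suc (length≡∑1 L)

  ∑-const : ∀ (L : List A) (k : ℕ) → ∑[ _ ∈ L ] k ≡ k * length L
  ∑-const L k = begin
    ∑[ _ ∈ L ] k       ≡⟨ ∑-cong L (λ _ → sym (*-identityʳ k)) ⟩
    ∑[ _ ∈ L ] (k * 1) ≡⟨ ∑-*ˡ L k (λ _ → 1) ⟩
    k * ∑[ _ ∈ L ] 1   ≡⟨ cong (k *_) (length≡∑1 L) ⟨
    k * length L       ∎

  count≡∑ : ∀ (p : A → Bool) (L : List A) → count p L ≡ ∑[ x ∈ L ] ⟦ p x ⟧
  count≡∑ p L = begin
    length (filter (λ x → T? (p x)) L)   ≡⟨ length≡∑1 (filter (λ x → T? (p x)) L) ⟩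
    ∑ (filter (λ x → T? (p x)) L) (λ _ → 1) ≡⟨ ∑-filter p L (λ _ → 1) ⟩
    ∑[ x ∈ L ] (⟦ p x ⟧ * 1)             ≡⟨ ∑-cong L (λ x → *-identityʳ _) ⟩
    ∑[ x ∈ L ] ⟦ p x ⟧                   ∎

∑-allFin-suc : ∀ n (f : Fin (suc n) → ℕ) → ∑ (allFin (suc n)) f ≡ f zero + ∑[ x ∈ allFin n ] f (suc x)
∑-allFin-suc n f = cong (f zero +_) (trans (cong (λ L → ∑ L f) (sym (map-tabulate id suc))) (∑-map suc (allFin n) f))

∑-allFin-const : ∀ n k → ∑[ _ ∈ allFin n ] k ≡ k * n
∑-allFin-const n k = trans (∑-const (allFin n) k) (cong (k *_) (length-tabulate id))

∑-allFin-+ : ∀ l M (f : Fin (l + M) → ℕ) → ∑ (allFin (l + M)) f ≡ ∑[ i ∈ allFin l ] f (i ↑ˡ M) + ∑[ j ∈ allFin M ] f (l ↑ʳ j)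
∑-allFin-+ zero M f = refl
∑-allFin-+ (suc l) M f = begin
  ∑ (allFin (suc l + M)) f
    ≡⟨ ∑-allFin-suc (l + M) f ⟩
  f zero + ∑[ x ∈ allFin (l + M) ] f (suc x)
    ≡⟨ cong (f zero +_) (∑-allFin-+ l M (f ∘ suc)) ⟩
  f zero + (∑[ i ∈ allFin l ] f (suc (i ↑ˡ M)) + ∑[ j ∈ allFin M ] f (suc l ↑ʳ j))
    ≡⟨ +-assoc (f zero) _ _ ⟨
  f zero + ∑[ i ∈ allFin l ] f (suc i ↑ˡ M) + ∑[ j ∈ allFin M ] f (suc l ↑ʳ j)
    ≡⟨ cong (_+ ∑[ j ∈ allFin M ] f (suc l ↑ʳ j)) (∑-allFin-suc l (λ i → f (i ↑ˡ M))) ⟨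
  ∑[ i ∈ allFin (suc l) ] f (i ↑ˡ M) + ∑[ j ∈ allFin M ] f (suc l ↑ʳ j) ∎
  where open ≡-Reasoning

module Kronecker {A : Set} (_≟_ : DecidableEquality A) where
  open ≡-Reasoning

  δ δ̄ : A → A → ℕ
  δ x y = ⟦ does (x ≟ y) ⟧
  δ̄ x y = ⟦ not (does (x ≟ y)) ⟧

  δ-refl : ∀ x → δ x x ≡ 1
  δ-refl x with x ≟ x
  ... | yes _ = refl
  ... | no x≢x = ⊥-elim (x≢x refl)

  δ-≢ : ∀ {x y} → x ≢ y → δ x y ≡ 0
  δ-≢ {x} {y} x≢y with x ≟ y
  ... | yes x≡y = ⊥-elim (x≢y x≡y)
  ... | no _ = refl

  δ̄-refl : ∀ x → δ̄ x x ≡ 0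
  δ̄-refl x with x ≟ x
  ... | yes _ = refl
  ... | no x≢x = ⊥-elim (x≢x refl)

  δ̄-≢ : ∀ {x y} → x ≢ y → δ̄ x y ≡ 1
  δ̄-≢ {x} {y} x≢y with x ≟ y
  ... | yes x≡y = ⊥-elim (x≢y x≡y)
  ... | no _ = refl

  δ+δ̄≡1 : ∀ x y → δ x y + δ̄ x y ≡ 1
  δ+δ̄≡1 x y with x ≟ y
  ... | yes _ = refl
  ... | no _ = refl

  δ-sym : ∀ x y → δ x y ≡ δ y x
  δ-sym x y with x ≟ y | y ≟ x
  ... | yes _ | yes _ = refl
  ... | no _ | no _ = refl
  ... | yes x≡y | no y≢x = ⊥-elim (y≢x (sym x≡y))
  ... | no x≢y | yes y≡x = ⊥-elim (x≢y (sym y≡x))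

  δ̄-sym : ∀ x y → δ̄ x y ≡ δ̄ y x
  δ̄-sym x y with x ≟ y | y ≟ x
  ... | yes _ | yes _ = refl
  ... | no _ | no _ = refl
  ... | yes x≡y | no y≢x = ⊥-elim (y≢x (sym x≡y))
  ... | no x≢y | yes y≡x = ⊥-elim (x≢y (sym y≡x))

  δ̄-idem : ∀ x y → δ̄ x y * δ̄ x y ≡ δ̄ x y
  δ̄-idem x y with x ≟ y
  ... | yes _ = refl
  ... | no _ = refl

  δ̄-refl-* : ∀ x k → δ̄ x x * k ≡ 0
  δ̄-refl-* x k = cong (_* k) (δ̄-refl x)

  δ-*-≤ : ∀ x y k → δ x y * k ≤ k
  δ-*-≤ x y k with x ≟ y
  ... | yes _ = ≤-reflexive (+-identityʳ k)
  ... | no _ = z≤n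

  δ-subst : ∀ x y (f : A → ℕ) → δ x y * f x ≡ δ x y * f y
  δ-subst x y f with x ≟ y
  ... | yes refl = refl
  ... | no _ = refl

  δ-injective : ∀ (g : A → A) → (∀ {x y} → g x ≡ g y → x ≡ y) → ∀ x y → δ (g x) (g y) ≡ δ x y
  δ-injective g g-inj x y with x ≟ y
  ... | yes refl = δ-refl (g x)
  ... | no x≢y = δ-≢ (x≢y ∘ g-inj)

  δ̄-injective : ∀ (g : A → A) → (∀ {x y} → g x ≡ g y → x ≡ y) → ∀ x y → δ̄ (g x) (g y) ≡ δ̄ x y
  δ̄-injective g g-inj x y with x ≟ y
  ... | yes refl = δ̄-refl (g x)
  ... | no x≢y = δ̄-≢ (x≢y ∘ g-inj)

  record IsEnumeration (L : List A) : Set where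
    constructor occurs-once
    field
      ∑-δ≡1 : ∀ z → ∑[ x ∈ L ] δ x z ≡ 1

  module _ {L : List A} (enum : IsEnumeration L) where
    open IsEnumeration enum

    ∑-δ : ∀ z (f : A → ℕ) → ∑[ x ∈ L ] (δ x z * f x) ≡ f z
    ∑-δ z f = begin
      ∑[ x ∈ L ] (δ x z * f x) ≡⟨ ∑-cong L (λ x → δ-subst x z f) ⟩
      ∑[ x ∈ L ] (δ x z * f z) ≡⟨ ∑-*ʳ L (f z) (λ x → δ x z) ⟩
      ∑[ x ∈ L ] δ x z * f z   ≡⟨ cong (_* f z) (∑-δ≡1 z) ⟩
      1 * f z                   ≡⟨ *-identityˡ (f z) ⟩
      f z                       ∎

    ∑-δˡ : ∀ z (f : A → ℕ) → ∑[ x ∈ L ] (δ z x * f x) ≡ f z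
    ∑-δˡ z f = trans (∑-cong L (λ x → cong (_* f x) (δ-sym z x))) (∑-δ z f)

    ∑-split : ∀ p (g : A → ℕ) → ∑ L g ≡ g p + ∑[ r ∈ L ] (δ̄ p r * g r)
    ∑-split p g = begin
      ∑ L g                                                  ≡⟨ ∑-cong L (λ r → trans (cong (_* g r) (δ+δ̄≡1 p r)) (*-identityˡ (g r))) ⟨
      ∑[ r ∈ L ] ((δ p r + δ̄ p r) * g r)                     ≡⟨ ∑-cong L (λ r → *-distribʳ-+ (g r) (δ p r) (δ̄ p r)) ⟩
      ∑[ r ∈ L ] (δ p r * g r + δ̄ p r * g r)                ≡⟨ ∑-+ L (λ r → δ p r * g r) _ ⟩
      ∑[ r ∈ L ] (δ p r * g r) + ∑[ r ∈ L ] (δ̄ p r * g r)  ≡⟨ cong (_+ ∑[ r ∈ L ] (δ̄ p r * g r)) (∑-δˡ p g) ⟩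
      g p + ∑[ r ∈ L ] (δ̄ p r * g r)                        ∎

    ∑-involution : (g : A → A) → (∀ x → g (g x) ≡ x) → (f : A → ℕ) → ∑[ x ∈ L ] f (g x) ≡ ∑ L f
    ∑-involution g g-invol f = sym (begin
      ∑ L f
        ≡⟨ ∑-cong L (λ x → trans (cong f (sym (g-invol x))) (sym (∑-δ (g x) (f ∘ g)))) ⟩
      ∑[ x ∈ L ] ∑[ y ∈ L ] (δ y (g x) * f (g y))
        ≡⟨ ∑-comm L L (λ x y → δ y (g x) * f (g y)) ⟩
      ∑[ y ∈ L ] ∑[ x ∈ L ] (δ y (g x) * f (g y))
        ≡⟨ ∑-cong L (λ y → ∑-*ʳ L (f (g y)) (λ x → δ y (g x))) ⟩
      ∑[ y ∈ L ] (∑[ x ∈ L ] δ y (g x) * f (g y))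
        ≡⟨ ∑-cong L (λ y → cong (_* f (g y)) (trans (∑-cong L (λ x → δ-g y x)) (∑-δ≡1 (g y)))) ⟩
      ∑[ y ∈ L ] (1 * f (g y))
        ≡⟨ ∑-cong L (λ y → *-identityˡ _) ⟩
      ∑[ y ∈ L ] f (g y)                              ∎)
      where
      δ-g : ∀ y x → δ y (g x) ≡ δ x (g y)
      δ-g y x with y ≟ g x | x ≟ g y
      ... | yes _ | yes _ = refl
      ... | no _ | no _ = refl
      ... | yes y≡gx | no x≢gy = ⊥-elim (x≢gy (trans (sym (g-invol x)) (cong g (sym y≡gx))))
      ... | no y≢gx | yes x≡gy = ⊥-elim (y≢gx (trans (sym (g-invol y)) (cong g (sym x≡gy))))

open module FinKronecker {n} = Kronecker (_≟ᶠ_ {n})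
module VecKronecker {n k} = Kronecker {Vec (Fin n) k} (≡-decᵛ _≟ᶠ_)
module ℕKronecker = Kronecker _≟_

allFin-isEnumeration : ∀ n → IsEnumeration (allFin n)
allFin-isEnumeration n = occurs-once (once n)
  where
  once : ∀ n (z : Fin n) → ∑[ x ∈ allFin n ] δ x z ≡ 1
  once (suc n) zero = trans (∑-allFin-suc n (λ x → δ x zero)) (cong suc (∑-zero (allFin n)))
  once (suc n) (suc z) = trans (∑-allFin-suc n (λ x → δ x (suc z))) (once n z)

⟦∧⟧ : ∀ b c → ⟦ b ∧ c ⟧ ≡ ⟦ b ⟧ * ⟦ c ⟧
⟦∧⟧ true c = sym (+-identityʳ ⟦ c ⟧)
⟦∧⟧ false c = refl

allVecs-isEnumeration : ∀ n k → VecKronecker.IsEnumeration (allVecs n k)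
allVecs-isEnumeration n k = VecKronecker.occurs-once (once k)
  where
  open ≡-Reasoning
  open VecKronecker using () renaming (δ to δᵛ)
  once : ∀ k (v : Vec (Fin n) k) → ∑[ w ∈ allVecs n k ] δᵛ w v ≡ 1
  once zero [] = refl
  once (suc k) (y ∷ w) = begin
      ∑[ v ∈ concatMap (λ x → map (x ∷_) (allVecs n k)) (allFin n) ] δᵛ v (y ∷ w)
        ≡⟨ ∑-concatMap (λ x → map (x ∷_) (allVecs n k)) (allFin n) _ ⟩
      ∑[ x ∈ allFin n ] ∑[ v ∈ map (x ∷_) (allVecs n k) ] δᵛ v (y ∷ w)
        ≡⟨ ∑-cong (allFin n) (λ x → trans (∑-map (x ∷_) (allVecs n k) _)
                                          (∑-cong (allVecs n k) (λ v → ⟦∧⟧ (does (x ≟ᶠ y)) (does (≡-decᵛ _≟ᶠ_ v w))))) ⟩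
      ∑[ x ∈ allFin n ] ∑[ v ∈ allVecs n k ] (δ x y * δᵛ v w)
        ≡⟨ ∑-cong (allFin n) (λ x → ∑-*ˡ (allVecs n k) (δ x y) _) ⟩
      ∑[ x ∈ allFin n ] (δ x y * ∑[ v ∈ allVecs n k ] δᵛ v w)
        ≡⟨ ∑-cong (allFin n) (λ x → trans (cong (δ x y *_) (once k w)) (*-identityʳ _)) ⟩
      ∑[ x ∈ allFin n ] δ x y
        ≡⟨ IsEnumeration.∑-δ≡1 (allFin-isEnumeration n) y ⟩
      1 ∎

-- Permutations, transpositions and conjugation

all-true : ∀ {p : A → Bool} (L : List A) → all p L ≡ true → ∀ {x} → x ∈ L → p x ≡ true
all-true {p = p} (y ∷ L) h (here refl) with p y
... | true = refl
all-true {p = p} (y ∷ L) h (there x∈L) with p y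
... | true = all-true L h x∈L

all-false : ∀ {p : A → Bool} (L : List A) → all p L ≡ false → ∃ λ x → p x ≡ false
all-false {p = p} (y ∷ L) h with p y in eq
... | true = all-false L h
... | false = y , eq

all-intro : ∀ {p : A → Bool} (L : List A) → (∀ {x} → x ∈ L → p x ≡ true) → all p L ≡ true
all-intro [] h = refl
all-intro {p = p} (y ∷ L) h with p y | h (here refl)
... | true | _ = all-intro L (h ∘ there)

all-cong : ∀ {p q : A → Bool} (L : List A) → (∀ x → p x ≡ q x) → all p L ≡ all q L
all-cong [] e = refl
all-cong (y ∷ L) e = cong₂ _∧_ (e y) (all-cong L e)

IsInjective : ∀ {n} → Vec (Fin n) n → Set
IsInjective ω = ∀ {x y} → lookup ω x ≡ lookup ω y → x ≡ y

-- The test inside isPerm is local to Defs, so it is reached only by case analysis on the two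
-- decisions it inspects.
isPerm⇒injective : ∀ {n} (ω : Vec (Fin n) n) → isPerm ω ≡ true → IsInjective ω
isPerm⇒injective {n} ω h {x} {y} ωx≡ωy
  with x ≟ᶠ y | all-true (allFin n) (all-true (allFin n) h (∈-allFin x)) (∈-allFin y)
... | yes x≡y | _ = x≡y
... | no _ | ok with lookup ω x ≟ᶠ lookup ω y | ok
...   | yes _ | ()
...   | no ωx≢ωy | _ = ⊥-elim (ωx≢ωy ωx≡ωy)

injective⇒isPerm : ∀ {n} (ω : Vec (Fin n) n) → IsInjective ω → isPerm ω ≡ true
injective⇒isPerm {n} ω inj = ¬-not not-false
  where
  not-false : isPerm ω ≢ false
  not-false h with all-false (allFin n) h
  ... | x , hx with all-false (allFin n) hx
  ... | y , hxy with x ≟ᶠ y | hxy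
  ...   | yes _ | ()
  ...   | no x≢y | hxy′ with lookup ω x ≟ᶠ lookup ω y | hxy′
  ...     | yes ωx≡ωy | _ = x≢y (inj ωx≡ωy)
  ...     | no _ | ()

module _ {n : ℕ} where

  transpose-matchˡ : ∀ (a b : Fin n) → transpose a b a ≡ b
  transpose-matchˡ a b with a ≟ᶠ a
  ... | yes _ = refl
  ... | no a≢a = ⊥-elim (a≢a refl)

  transpose-matchʳ : ∀ (a b : Fin n) → transpose a b b ≡ a
  transpose-matchʳ a b with b ≟ᶠ a
  ... | yes b≡a = b≡a
  ... | no _ with b ≟ᶠ b
  ...   | yes _ = refl
  ...   | no b≢b = ⊥-elim (b≢b refl)

  transpose-other : ∀ (a b : Fin n) {x} → x ≢ a → x ≢ b → transpose a b x ≡ x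
  transpose-other a b {x} x≢a x≢b with x ≟ᶠ a
  ... | yes x≡a = ⊥-elim (x≢a x≡a)
  ... | no _ with x ≟ᶠ b
  ...   | yes x≡b = ⊥-elim (x≢b x≡b)
  ...   | no _ = refl

  transpose-involutive : ∀ (a b : Fin n) → Involutive _≡_ (transpose a b)
  transpose-involutive a b x with x ≟ᶠ a
  ... | yes refl = transpose-matchʳ x b
  ... | no x≢a with x ≟ᶠ b
  ...   | yes refl = transpose-matchˡ a x
  ...   | no x≢b = transpose-other a b x≢a x≢b

  transpose-injective : ∀ (a b : Fin n) {x y} → transpose a b x ≡ transpose a b y → x ≡ y
  transpose-injective a b {x} {y} e =
    trans (sym (transpose-involutive a b x)) (trans (cong (transpose a b) e) (transpose-involutive a b y))

≟-injective : ∀ {N N′} (h : Fin N → Fin N′) → (∀ {a b} → h a ≡ h b → a ≡ b) → ∀ a b → ⌊ h a ≟ᶠ h b ⌋ ≡ ⌊ a ≟ᶠ b ⌋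
≟-injective h h-inj a b with h a ≟ᶠ h b | a ≟ᶠ b
... | yes _ | yes _ = refl
... | no _ | no _ = refl
... | yes ha≡hb | no a≢b = ⊥-elim (a≢b (h-inj ha≡hb))
... | no ha≢hb | yes refl = ⊥-elim (ha≢hb refl)

conjugate : ∀ {n} → Fin n → Fin n → Vec (Fin n) n → Vec (Fin n) n
conjugate a b ω = tabulate (transpose a b ∘ lookup ω ∘ transpose a b)

module _ {n : ℕ} (i j : Fin n) where
  private
    τ : Fin n → Fin n
    τ = transpose i j
    τ-invol : Involutive _≡_ τ
    τ-invol = transpose-involutive i j

  lookup-conjugate : ∀ ω x → lookup (conjugate i j ω) x ≡ τ (lookup ω (τ x))
  lookup-conjugate ω = lookup∘tabulate _

  lookup-conjugate-τ : ∀ ω x → lookup (conjugate i j ω) (τ x) ≡ τ (lookup ω x)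
  lookup-conjugate-τ ω x = trans (lookup-conjugate ω (τ x)) (cong (τ ∘ lookup ω) (τ-invol x))

  conjugate-involutive : Involutive _≡_ (conjugate i j)
  conjugate-involutive ω = trans (tabulate-cong λ x → trans (cong τ (lookup-conjugate ω (τ x)))
                                                      (trans (τ-invol _) (cong (lookup ω) (τ-invol x))))
                                 (tabulate∘lookup ω)

  conjugate-injective : ∀ ω → IsInjective ω → IsInjective (conjugate i j ω)
  conjugate-injective ω inj {x} {y} e = transpose-injective i j (inj (transpose-injective i j
    (trans (sym (lookup-conjugate ω x)) (trans e (lookup-conjugate ω y)))))

  isPerm-conjugate : ∀ ω → isPerm (conjugate i j ω) ≡ isPerm ω
  isPerm-conjugate ω = ⇔→≡ {z = true} (mk⇔
    (λ h → injective⇒isPerm ω (subst IsInjective (conjugate-involutive ω)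
             (conjugate-injective (conjugate i j ω) (isPerm⇒injective (conjugate i j ω) h))))
    (λ h → injective⇒isPerm (conjugate i j ω) (conjugate-injective ω (isPerm⇒injective ω h))))

  ≟-transpose : ∀ u x → ⌊ τ u ≟ᶠ x ⌋ ≡ ⌊ u ≟ᶠ τ x ⌋
  ≟-transpose u x = trans (cong (λ z → ⌊ τ u ≟ᶠ z ⌋) (sym (τ-invol x))) (≟-injective τ (transpose-injective i j) u (τ x))

  iter-conjugate : ∀ ω k x → iter (conjugate i j ω) k x ≡ τ (iter ω k (τ x))
  iter-conjugate ω zero x = sym (τ-invol x)
  iter-conjugate ω (suc k) x = trans (cong (lookup (conjugate i j ω)) (iter-conjugate ω k x)) (lookup-conjugate-τ ω _)

  firstReturn-conjugate : ∀ ω x k fuel → firstReturn (conjugate i j ω) x k fuel ≡ firstReturn ω (τ x) k fuel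
  firstReturn-conjugate ω x k zero = refl
  firstReturn-conjugate ω x k (suc fuel) =
    cong₂ (λ c r → if c then k else r)
      (trans (cong (λ z → ⌊ z ≟ᶠ x ⌋) (iter-conjugate ω k x)) (≟-transpose _ x))
      (firstReturn-conjugate ω x (suc k) fuel)

  cycLen-conjugate : ∀ ω x → cycLen (conjugate i j ω) x ≡ cycLen ω (τ x)
  cycLen-conjugate ω x = firstReturn-conjugate ω x 1 n

  hasCycleType-conjugate : ∀ (a : ℕ → ℕ) ω → hasCycleType a (conjugate i j ω) ≡ hasCycleType a ω
  hasCycleType-conjugate a ω = all-cong (upTo n) (λ r → cong (_≡ᵇ suc r * a (suc r)) (count-cycLen (suc r)))
    where
    count-cycLen : ∀ s → count (λ x → cycLen (conjugate i j ω) x ≡ᵇ s) (allFin n) ≡ count (λ x → cycLen ω x ≡ᵇ s) (allFin n)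
    count-cycLen s = begin
      count (λ x → cycLen (conjugate i j ω) x ≡ᵇ s) (allFin n)
        ≡⟨ count≡∑ _ (allFin n) ⟩
      ∑[ x ∈ allFin n ] ⟦ cycLen (conjugate i j ω) x ≡ᵇ s ⟧
        ≡⟨ ∑-cong (allFin n) (λ x → cong (λ z → ⟦ z ≡ᵇ s ⟧) (cycLen-conjugate ω x)) ⟩
      ∑[ x ∈ allFin n ] ⟦ cycLen ω (τ x) ≡ᵇ s ⟧
        ≡⟨ ∑-involution (allFin-isEnumeration n) τ τ-invol (λ x → ⟦ cycLen ω x ≡ᵇ s ⟧) ⟩
      ∑[ x ∈ allFin n ] ⟦ cycLen ω x ≡ᵇ s ⟧                   ≡⟨ count≡∑ _ (allFin n) ⟨
      count (λ x → cycLen ω x ≡ᵇ s) (allFin n)               ∎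
      where open ≡-Reasoning

-- Sums over a conjugacy class

-- The class sum runs over all maps [n] → [n] weighted by the indicator of C_λ, so that conjugation
-- acts on it by reindexing.
module ClassSum (n : ℕ) (a : ℕ → ℕ) where

  inClass : Vec (Fin n) n → ℕ
  inClass ω = ⟦ isPerm ω ⟧ * ⟦ hasCycleType a ω ⟧

  ∑ᶜ : (Vec (Fin n) n → ℕ) → ℕ
  ∑ᶜ f = ∑[ ω ∈ allVecs n n ] (inClass ω * f ω)

  syntax ∑ᶜ (λ ω → e) = ∑ᶜ[ ω ] e

  ∑-Class : ∀ f → ∑ (Class n a) f ≡ ∑ᶜ f
  ∑-Class f = trans (∑-filter (hasCycleType a) (Sym n) f)
    (trans (∑-filter isPerm (allVecs n n) _) (∑-cong (allVecs n n) (λ ω → sym (*-assoc ⟦ isPerm ω ⟧ _ (f ω)))))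

  count-Class : ∀ p → count p (Class n a) ≡ ∑ᶜ[ ω ] ⟦ p ω ⟧
  count-Class p = trans (count≡∑ p (Class n a)) (∑-Class _)

  length-Class : length (Class n a) ≡ ∑ᶜ[ _ ] 1
  length-Class = trans (length≡∑1 (Class n a)) (∑-Class _)

  ∑ᶜ-cong : ∀ {f g} → (∀ ω → f ω ≡ g ω) → ∑ᶜ f ≡ ∑ᶜ g
  ∑ᶜ-cong e = ∑-cong (allVecs n n) (λ ω → cong (inClass ω *_) (e ω))

  ∑ᶜ-cong-Class : ∀ {f g} → (∀ ω → isPerm ω ≡ true → hasCycleType a ω ≡ true → f ω ≡ g ω) → ∑ᶜ f ≡ ∑ᶜ g
  ∑ᶜ-cong-Class {f} {g} e = ∑-cong (allVecs n n) (λ ω → on-class ω (isPerm ω) (hasCycleType a ω) refl refl)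
    where
    on-class : ∀ ω b c → isPerm ω ≡ b → hasCycleType a ω ≡ c → ⟦ b ⟧ * ⟦ c ⟧ * f ω ≡ ⟦ b ⟧ * ⟦ c ⟧ * g ω
    on-class ω true true perm type = cong (_+ 0) (e ω perm type)
    on-class ω true false _ _ = refl
    on-class ω false c _ _ = refl

  ∑ᶜ-+ : ∀ f g → ∑ᶜ[ ω ] (f ω + g ω) ≡ ∑ᶜ f + ∑ᶜ g
  ∑ᶜ-+ f g = trans (∑-cong (allVecs n n) (λ ω → *-distribˡ-+ (inClass ω) (f ω) (g ω))) (∑-+ (allVecs n n) _ _)

  ∑ᶜ-*ˡ : ∀ k f → ∑ᶜ[ ω ] (k * f ω) ≡ k * ∑ᶜ f
  ∑ᶜ-*ˡ k f = trans (∑-cong (allVecs n n) (λ ω → x*yz≡y*xz (inClass ω) k (f ω))) (∑-*ˡ (allVecs n n) k _)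

  ∑ᶜ-const : ∀ k → ∑ᶜ[ _ ] k ≡ k * ∑ᶜ[ _ ] 1
  ∑ᶜ-const k = trans (∑ᶜ-cong (λ _ → sym (*-identityʳ k))) (∑ᶜ-*ˡ k (λ _ → 1))

  ∑ᶜ-∑ : ∀ (L : List A) (f : A → Vec (Fin n) n → ℕ) → ∑ᶜ[ ω ] ∑[ x ∈ L ] f x ω ≡ ∑[ x ∈ L ] ∑ᶜ (f x)
  ∑ᶜ-∑ L f = trans (∑-cong (allVecs n n) (λ ω → sym (∑-*ˡ L (inClass ω) (λ x → f x ω)))) (∑-comm (allVecs n n) L _)

  ∑ᶜ-positive : ∀ ω → isPerm ω ≡ true → hasCycleType a ω ≡ true → 0 < ∑ᶜ[ _ ] 1
  ∑ᶜ-positive ω perm type = begin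
    1                                                ≡⟨ cong₂ (λ u v → ⟦ u ⟧ * ⟦ v ⟧ * 1) perm type ⟨
    inClass ω * 1                                    ≡⟨ ∑-δᵛ (allVecs-isEnumeration n n) ω (λ v → inClass v * 1) ⟨
    ∑[ v ∈ allVecs n n ] (δᵛ v ω * (inClass v * 1))  ≤⟨ ∑-mono-≤ (allVecs n n) (λ v → δᵛ-*-≤ v ω (inClass v * 1)) ⟩
    ∑ᶜ[ _ ] 1                                        ∎
    where
    open ≤-Reasoning
    open VecKronecker using () renaming (δ to δᵛ; δ-*-≤ to δᵛ-*-≤; ∑-δ to ∑-δᵛ)

  inClass-conjugate : ∀ (x y : Fin n) ω → inClass (conjugate x y ω) ≡ inClass ω
  inClass-conjugate x y ω = cong₂ (λ u v → ⟦ u ⟧ * ⟦ v ⟧) (isPerm-conjugate x y ω) (hasCycleType-conjugate x y a ω)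

  ∑ᶜ-conjugate : ∀ (x y : Fin n) f → ∑ᶜ[ ω ] f (conjugate x y ω) ≡ ∑ᶜ f
  ∑ᶜ-conjugate x y f = begin
    ∑ᶜ[ ω ] f (conjugate x y ω)
      ≡⟨ ∑-cong (allVecs n n) (λ ω → cong (_* f (conjugate x y ω)) (inClass-conjugate x y ω)) ⟨
    ∑[ ω ∈ allVecs n n ] (inClass (conjugate x y ω) * f (conjugate x y ω))
      ≡⟨ VecKronecker.∑-involution (allVecs-isEnumeration n n) (conjugate x y) (conjugate-involutive x y) _ ⟩
    ∑ᶜ f ∎
    where open ≡-Reasoning

-- Fixed points, 2-cycles and sums over distinct points

firstReturn-≥ : ∀ {n} (ω : Vec (Fin n) n) x k fuel → firstReturn ω x k fuel ≡ 0 ⊎ k ≤ firstReturn ω x k fuel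
firstReturn-≥ ω x k zero = inj₁ refl
firstReturn-≥ ω x k (suc fuel) with ⌊ iter ω k x ≟ᶠ x ⌋
... | true = inj₂ ≤-refl
... | false with firstReturn-≥ ω x (suc k) fuel
...   | inj₁ none = inj₁ none
...   | inj₂ k<r = inj₂ (≤-trans (n≤1+n k) k<r)

firstReturn-≢ : ∀ {n} (ω : Vec (Fin n) n) x k fuel {r} → 0 < r → r < k → firstReturn ω x k fuel ≢ r
firstReturn-≢ ω x k fuel 0<r r<k eq with firstReturn-≥ ω x k fuel
... | inj₁ none = <-irrefl (trans (sym none) eq) 0<r
... | inj₂ k≤ = <-irrefl refl (≤-trans r<k (subst (k ≤_) eq k≤))

module _ {m : ℕ} (ω : Vec (Fin (suc (suc m))) (suc (suc m))) where
  open ℕKronecker using () renaming (δ-≢ to δℕ-≢)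

  isFixed isIn2Cycle : Fin (suc (suc m)) → ℕ
  isFixed x = δ (lookup ω x) x
  isIn2Cycle x = δ̄ (lookup ω x) x * δ (lookup ω (lookup ω x)) x

  cycLen≡1 : ∀ x → ⟦ cycLen ω x ≡ᵇ 1 ⟧ ≡ isFixed x
  cycLen≡1 x with lookup ω x ≟ᶠ x
  ... | yes _ = refl
  ... | no _ with lookup ω (lookup ω x) ≟ᶠ x
  ...   | yes _ = refl
  ...   | no _ = δℕ-≢ (firstReturn-≢ ω x 3 m (s≤s z≤n) (s≤s (s≤s z≤n)))

  cycLen≡2 : ∀ x → ⟦ cycLen ω x ≡ᵇ 2 ⟧ ≡ isIn2Cycle x
  cycLen≡2 x with lookup ω x ≟ᶠ x
  ... | yes _ = refl
  ... | no _ with lookup ω (lookup ω x) ≟ᶠ x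
  ...   | yes _ = refl
  ...   | no _ = δℕ-≢ (firstReturn-≢ ω x 3 m (s≤s z≤n) (s≤s (s≤s (s≤s z≤n))))

  module _ (a : ℕ → ℕ) (type : hasCycleType a ω ≡ true) where

    count-cycLen : ∀ r → r < suc (suc m) → ∑[ x ∈ allFin (suc (suc m)) ] ⟦ cycLen ω x ≡ᵇ suc r ⟧ ≡ suc r * a (suc r)
    count-cycLen r r<n = trans (sym (count≡∑ (λ x → cycLen ω x ≡ᵇ suc r) (allFin _)))
      (≡ᵇ⇒≡ _ _ (subst T (sym (all-true {p = λ r → count (λ x → cycLen ω x ≡ᵇ suc r) (allFin _) ≡ᵇ suc r * a (suc r)}
                                           (upTo (suc (suc m))) type (∈-upTo⁺ r<n))) _))

    ∑-isFixed : ∑[ x ∈ allFin (suc (suc m)) ] isFixed x ≡ a 1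
    ∑-isFixed = trans (sym (∑-cong (allFin _) cycLen≡1)) (trans (count-cycLen 0 (s≤s z≤n)) (+-identityʳ _))

    ∑-isIn2Cycle : ∑[ x ∈ allFin (suc (suc m)) ] isIn2Cycle x ≡ 2 * a 2
    ∑-isIn2Cycle = trans (sym (∑-cong (allFin _) cycLen≡2)) (count-cycLen 1 (s≤s (s≤s z≤n)))

∑-δ̄ : ∀ k (p : Fin (suc k)) → ∑[ r ∈ allFin (suc k) ] δ̄ p r ≡ k
∑-δ̄ k p = suc-injective (begin
  suc (∑[ r ∈ allFin (suc k) ] δ̄ p r)         ≡⟨ cong suc (∑-cong (allFin (suc k)) (λ r → *-identityʳ (δ̄ p r))) ⟨
  1 + ∑[ r ∈ allFin (suc k) ] (δ̄ p r * 1)     ≡⟨ ∑-split (allFin-isEnumeration (suc k)) p (λ _ → 1) ⟨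
  ∑[ _ ∈ allFin (suc k) ] 1                    ≡⟨ trans (∑-allFin-const (suc k) 1) (*-identityˡ (suc k)) ⟩
  suc k                                        ∎)
  where open ≡-Reasoning

∑-δ̄δ̄ : ∀ k (p q : Fin (suc (suc k))) → p ≢ q → ∑[ r ∈ allFin (suc (suc k)) ] (δ̄ p r * δ̄ q r) ≡ k
∑-δ̄δ̄ k p q p≢q = suc-injective (begin
  suc (∑[ r ∈ allFin (suc (suc k)) ] (δ̄ p r * δ̄ q r))
    ≡⟨ cong (_+ ∑[ r ∈ allFin (suc (suc k)) ] (δ̄ p r * δ̄ q r)) (trans (δ̄-sym q p) (δ̄-≢ p≢q)) ⟨
  δ̄ q p + ∑[ r ∈ allFin (suc (suc k)) ] (δ̄ p r * δ̄ q r)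
    ≡⟨ ∑-split (allFin-isEnumeration (suc (suc k))) p (δ̄ q) ⟨
  ∑[ r ∈ allFin (suc (suc k)) ] δ̄ q r
    ≡⟨ ∑-δ̄ (suc k) q ⟩
  suc k                                                   ∎)
  where open ≡-Reasoning

∑≠² : ∀ {n} → (Fin n → Fin n → ℕ) → ℕ
∑≠² {n} h = ∑[ p ∈ allFin n ] ∑[ r ∈ allFin n ] (δ̄ p r * h p r)

distinct³ : ∀ {n} → Fin n → Fin n → Fin n → ℕ
distinct³ p q r = δ̄ p q * δ̄ p r * δ̄ q r

∑≠³ : ∀ {n} → (Fin n → Fin n → Fin n → ℕ) → ℕ
∑≠³ {n} h = ∑[ p ∈ allFin n ] ∑[ q ∈ allFin n ] ∑[ r ∈ allFin n ] (distinct³ p q r * h p q r)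

∑≠²-const : ∀ {k} (h : Fin (suc k) → Fin (suc k) → ℕ) c → (∀ {p r} → p ≢ r → h p r ≡ c) →
            ∑≠² h ≡ c * (suc k * k)
∑≠²-const {k} h c const = begin
  ∑≠² h                                          ≡⟨ ∑-cong (allFin (suc k)) (λ p → ∑-cong (allFin (suc k)) (λ r → on-pair p r (p ≟ᶠ r))) ⟩
  ∑[ p ∈ allFin (suc k) ] ∑[ r ∈ allFin (suc k) ] (δ̄ p r * c)
    ≡⟨ ∑-cong (allFin (suc k)) (λ p → trans (∑-*ʳ (allFin (suc k)) c (δ̄ p)) (cong (_* c) (∑-δ̄ k p))) ⟩
  ∑[ _ ∈ allFin (suc k) ] (k * c)                ≡⟨ ∑-allFin-const (suc k) (k * c) ⟩
  k * c * suc k                                  ≡⟨ rearrange k c ⟩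
  c * (suc k * k)                                ∎
  where
  open ≡-Reasoning
  rearrange : ∀ k c → k * c * suc k ≡ c * (suc k * k)
  rearrange = solve-∀
  on-pair : ∀ p r → Dec (p ≡ r) → δ̄ p r * h p r ≡ δ̄ p r * c
  on-pair p r (yes refl) = trans (δ̄-refl-* p (h p p)) (sym (δ̄-refl-* p c))
  on-pair p r (no p≢r) = cong (δ̄ p r *_) (const p≢r)

∑≠³-const : ∀ {k} (h : Fin (suc (suc k)) → Fin (suc (suc k)) → Fin (suc (suc k)) → ℕ) c →
            (∀ {p q r} → p ≢ q → p ≢ r → q ≢ r → h p q r ≡ c) →
            ∑≠³ h ≡ c * (suc (suc k) * suc k * k)
∑≠³-const {k} h c const = begin
  ∑≠³ h
    ≡⟨ ∑-cong Fn (λ p → ∑-cong Fn (λ q → ∑-cong Fn (λ r → on-triple p q r (p ≟ᶠ q) (p ≟ᶠ r) (q ≟ᶠ r)))) ⟩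
  ∑[ p ∈ Fn ] ∑[ q ∈ Fn ] ∑[ r ∈ Fn ] (distinct³ p q r * c)
    ≡⟨ ∑-cong Fn (λ p → ∑-cong Fn (λ q → ∑-distinct³ p q (p ≟ᶠ q))) ⟩
  ∑[ p ∈ Fn ] ∑[ q ∈ Fn ] (δ̄ p q * (k * c))
    ≡⟨ ∑-cong Fn (λ p → trans (∑-*ʳ Fn _ (δ̄ p)) (cong (_* (k * c)) (∑-δ̄ (suc k) p))) ⟩
  ∑[ _ ∈ Fn ] (suc k * (k * c))
    ≡⟨ ∑-allFin-const (suc (suc k)) (suc k * (k * c)) ⟩
  suc k * (k * c) * suc (suc k)
    ≡⟨ rearrange k c ⟩
  c * (suc (suc k) * suc k * k) ∎
  where
  open ≡-Reasoning
  Fn : List (Fin (suc (suc k)))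
  Fn = allFin (suc (suc k))
  rearrange : ∀ k c → suc k * (k * c) * suc (suc k) ≡ c * (suc (suc k) * suc k * k)
  rearrange = solve-∀
  ∑-distinct³ : ∀ p q → Dec (p ≡ q) → ∑[ r ∈ Fn ] (distinct³ p q r * c) ≡ δ̄ p q * (k * c)
  ∑-distinct³ p q (yes refl) = begin
    ∑[ r ∈ Fn ] (δ̄ p p * δ̄ p r * δ̄ p r * c) ≡⟨ ∑-cong Fn (λ r → cong (λ x → x * δ̄ p r * δ̄ p r * c) (δ̄-refl p)) ⟩
    ∑[ r ∈ Fn ] 0                            ≡⟨ ∑-zero Fn ⟩
    0                                        ≡⟨ δ̄-refl-* p (k * c) ⟨
    δ̄ p p * (k * c)                          ∎
  ∑-distinct³ p q (no p≢q) = begin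
    ∑[ r ∈ Fn ] (δ̄ p q * δ̄ p r * δ̄ q r * c) ≡⟨ ∑-cong Fn (λ r → cong (λ x → x * δ̄ p r * δ̄ q r * c) (δ̄-≢ p≢q)) ⟩
    ∑[ r ∈ Fn ] (1 * δ̄ p r * δ̄ q r * c)     ≡⟨ ∑-cong Fn (λ r → cong (λ x → x * δ̄ q r * c) (*-identityˡ (δ̄ p r))) ⟩
    ∑[ r ∈ Fn ] (δ̄ p r * δ̄ q r * c)         ≡⟨ ∑-*ʳ Fn c (λ r → δ̄ p r * δ̄ q r) ⟩
    ∑[ r ∈ Fn ] (δ̄ p r * δ̄ q r) * c         ≡⟨ cong (_* c) (∑-δ̄δ̄ k p q p≢q) ⟩
    k * c                                    ≡⟨ *-identityˡ (k * c) ⟨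
    1 * (k * c)                              ≡⟨ cong (_* (k * c)) (δ̄-≢ p≢q) ⟨
    δ̄ p q * (k * c)                          ∎
  on-triple : ∀ p q r → Dec (p ≡ q) → Dec (p ≡ r) → Dec (q ≡ r) → distinct³ p q r * h p q r ≡ distinct³ p q r * c
  on-triple p q r (yes refl) _ _ rewrite δ̄-refl p = refl
  on-triple p q r (no _) (yes refl) _ rewrite δ̄-refl p | *-zeroʳ (δ̄ p q) = refl
  on-triple p q r (no _) (no _) (yes refl) rewrite δ̄-refl q | *-zeroʳ (δ̄ p q * δ̄ p q) = refl
  on-triple p q r (no p≢q) (no p≢r) (no q≢r) = cong (distinct³ p q r *_) (const p≢q p≢r q≢r)

module _ {n : ℕ} where
  open ≡-Reasoning

  transpose-invariant²⇒const :
    (h : Fin n → Fin n → ℕ) → (∀ a b p r → h (transpose a b p) (transpose a b r) ≡ h p r) →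
    ∀ {p r p′ r′} → p ≢ r → p′ ≢ r′ → h p r ≡ h p′ r′
  transpose-invariant²⇒const h inv {p} {r} {p′} {r′} p≢r p′≢r′ = begin
    h p r                                  ≡⟨ inv p p′ p r ⟨
    h (transpose p p′ p) r₁                ≡⟨ cong (λ z → h z r₁) (transpose-matchˡ p p′) ⟩
    h p′ r₁                                ≡⟨ inv r₁ r′ p′ r₁ ⟨
    h (transpose r₁ r′ p′) (transpose r₁ r′ r₁) ≡⟨ cong₂ h (transpose-other r₁ r′ p′≢r₁ p′≢r′) (transpose-matchˡ r₁ r′) ⟩
    h p′ r′                                ∎
    where
    r₁ : Fin n
    r₁ = transpose p p′ r
    p′≢r₁ : p′ ≢ r₁
    p′≢r₁ e = p≢r (transpose-injective p p′ (trans (transpose-matchˡ p p′) e))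

  transpose-invariant³⇒const :
    (h : Fin n → Fin n → Fin n → ℕ) →
    (∀ a b p q r → h (transpose a b p) (transpose a b q) (transpose a b r) ≡ h p q r) →
    ∀ {p q r p′ q′ r′} → p ≢ q → p ≢ r → q ≢ r → p′ ≢ q′ → p′ ≢ r′ → q′ ≢ r′ → h p q r ≡ h p′ q′ r′
  transpose-invariant³⇒const h inv {p} {q} {r} {p′} {q′} {r′} p≢q p≢r q≢r p′≢q′ p′≢r′ q′≢r′ = begin
    h p q r                                    ≡⟨ inv p p′ p q r ⟨
    h (transpose p p′ p) q₁ r₁
      ≡⟨ cong (λ z → h z q₁ r₁) (transpose-matchˡ p p′) ⟩
    h p′ q₁ r₁                                 ≡⟨ inv q₁ q′ p′ q₁ r₁ ⟨
    h (transpose q₁ q′ p′) (transpose q₁ q′ q₁) r₂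
      ≡⟨ cong₂ (λ u v → h u v r₂) (transpose-other q₁ q′ p′≢q₁ p′≢q′) (transpose-matchˡ q₁ q′) ⟩
    h p′ q′ r₂                                 ≡⟨ inv r₂ r′ p′ q′ r₂ ⟨
    h (transpose r₂ r′ p′) (transpose r₂ r′ q′) (transpose r₂ r′ r₂)
      ≡⟨ cong₃ h (transpose-other r₂ r′ p′≢r₂ p′≢r′) (transpose-other r₂ r′ q′≢r₂ q′≢r′) (transpose-matchˡ r₂ r′) ⟩
    h p′ q′ r′ ∎
    where
    cong₃ : ∀ (f : Fin n → Fin n → Fin n → ℕ) {x y z x′ y′ z′} → x ≡ x′ → y ≡ y′ → z ≡ z′ → f x y z ≡ f x′ y′ z′
    cong₃ f refl refl refl = refl
    q₁ r₁ r₂ : Fin n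
    q₁ = transpose p p′ q
    r₁ = transpose p p′ r
    r₂ = transpose q₁ q′ r₁
    p′≢q₁ : p′ ≢ q₁
    p′≢q₁ e = p≢q (transpose-injective p p′ (trans (transpose-matchˡ p p′) e))
    p′≢r₁ : p′ ≢ r₁
    p′≢r₁ e = p≢r (transpose-injective p p′ (trans (transpose-matchˡ p p′) e))
    p′≢r₂ : p′ ≢ r₂
    p′≢r₂ e = p′≢r₁ (transpose-injective q₁ q′ (trans (transpose-other q₁ q′ p′≢q₁ p′≢q′) e))
    q′≢r₂ : q′ ≢ r₂
    q′≢r₂ e = q≢r (transpose-injective p p′ (transpose-injective q₁ q′ (trans (transpose-matchˡ q₁ q′) e)))

module _ {m : ℕ} (a : ℕ → ℕ) (ω : Vec (Fin (suc (suc m))) (suc (suc m)))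
         (perm : isPerm ω ≡ true) (type : hasCycleType a ω ≡ true) where
  open ≡-Reasoning
  private
    n : ℕ
    n = suc (suc m)
    Fn : List (Fin n)
    Fn = allFin n
    o : Fin n → Fin n
    o = lookup ω
    enum : IsEnumeration Fn
    enum = allFin-isEnumeration n
    A1 : ∑[ x ∈ Fn ] isFixed ω x ≡ a 1
    A1 = ∑-isFixed ω a type
    A2 : ∑[ x ∈ Fn ] isIn2Cycle ω x ≡ 2 * a 2
    A2 = ∑-isIn2Cycle ω a type

  ∑≠²-fixed-fixed : ∑≠² (λ p r → isFixed ω p * isFixed ω r) ≡ a 1 * (a 1 ∸ 1)
  ∑≠²-fixed-fixed = begin
    ∑≠² (λ p r → isFixed ω p * isFixed ω r)
      ≡⟨ ∑-cong Fn (λ p → trans (∑-cong Fn (λ r → x*yz≡y*xz (δ̄ p r) (isFixed ω p) (isFixed ω r)))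
                                (∑-*ˡ Fn (isFixed ω p) (λ r → δ̄ p r * isFixed ω r))) ⟩
    ∑[ p ∈ Fn ] (isFixed ω p * ∑[ r ∈ Fn ] (δ̄ p r * isFixed ω r))
      ≡⟨ ∑-cong Fn (λ p → per-point p (o p ≟ᶠ p)) ⟩
    ∑[ p ∈ Fn ] (isFixed ω p * (a 1 ∸ 1))
      ≡⟨ ∑-*ʳ Fn (a 1 ∸ 1) (isFixed ω) ⟩
    ∑[ p ∈ Fn ] isFixed ω p * (a 1 ∸ 1)
      ≡⟨ cong (_* (a 1 ∸ 1)) A1 ⟩
    a 1 * (a 1 ∸ 1) ∎
    where
    per-point : ∀ p → Dec (o p ≡ p) → isFixed ω p * ∑[ r ∈ Fn ] (δ̄ p r * isFixed ω r) ≡ isFixed ω p * (a 1 ∸ 1)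
    per-point p (no op≢p) rewrite δ-≢ op≢p = refl
    per-point p (yes op≡p) = cong (isFixed ω p *_) (sym (begin
      a 1 ∸ 1                                   ≡⟨ cong (_∸ 1) (trans (sym A1) (∑-split enum p (isFixed ω))) ⟩
      isFixed ω p + ∑[ r ∈ Fn ] (δ̄ p r * isFixed ω r) ∸ 1 ≡⟨ cong (λ z → z + ∑[ r ∈ Fn ] (δ̄ p r * isFixed ω r) ∸ 1) p-fixed ⟩
      ∑[ r ∈ Fn ] (δ̄ p r * isFixed ω r)         ∎))
      where
      p-fixed : isFixed ω p ≡ 1
      p-fixed = trans (cong (λ z → δ z p) op≡p) (δ-refl p)

  ∑≠²-swapped : ∑≠² (λ p r → δ (o p) r * δ (o r) p) ≡ 2 * a 2
  ∑≠²-swapped = trans (∑-cong Fn per-point) A2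
    where
    per-point : ∀ p → ∑[ r ∈ Fn ] (δ̄ p r * (δ (o p) r * δ (o r) p)) ≡ isIn2Cycle ω p
    per-point p = begin
      ∑[ r ∈ Fn ] (δ̄ p r * (δ (o p) r * δ (o r) p)) ≡⟨ ∑-cong Fn (λ r → x*yz≡y*xz (δ̄ p r) (δ (o p) r) (δ (o r) p)) ⟩
      ∑[ r ∈ Fn ] (δ (o p) r * (δ̄ p r * δ (o r) p)) ≡⟨ ∑-δˡ enum (o p) (λ r → δ̄ p r * δ (o r) p) ⟩
      δ̄ p (o p) * δ (o (o p)) p                      ≡⟨ cong (_* δ (o (o p)) p) (δ̄-sym p (o p)) ⟩
      isIn2Cycle ω p                                  ∎

  ∑≠³-maps-fixed : ∑≠³ (λ p q r → δ (o p) q * isFixed ω r) + a 1 * a 1 ≡ n * a 1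
  ∑≠³-maps-fixed = begin
    ∑≠³ (λ p q r → δ (o p) q * isFixed ω r) + a 1 * a 1
      ≡⟨ cong₂ _+_ (∑-cong Fn per-point) (cong (_* a 1) (sym A1)) ⟩
    ∑[ p ∈ Fn ] (δ̄ p (o p) * a 1) + ∑[ p ∈ Fn ] isFixed ω p * a 1
      ≡⟨ cong (_+ ∑[ p ∈ Fn ] isFixed ω p * a 1) (∑-*ʳ Fn (a 1) (λ p → δ̄ p (o p))) ⟩
    ∑[ p ∈ Fn ] δ̄ p (o p) * a 1 + ∑[ p ∈ Fn ] isFixed ω p * a 1
      ≡⟨ *-distribʳ-+ (a 1) (∑[ p ∈ Fn ] δ̄ p (o p)) (∑[ p ∈ Fn ] isFixed ω p) ⟨
    (∑[ p ∈ Fn ] δ̄ p (o p) + ∑[ p ∈ Fn ] isFixed ω p) * a 1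
      ≡⟨ cong (_* a 1) (trans (sym (∑-+ Fn (λ p → δ̄ p (o p)) (isFixed ω))) (∑-cong Fn moved-or-fixed)) ⟩
    ∑[ _ ∈ Fn ] 1 * a 1
      ≡⟨ cong (_* a 1) (trans (∑-allFin-const n 1) (*-identityˡ n)) ⟩
    n * a 1 ∎
    where
    moved-or-fixed : ∀ p → δ̄ p (o p) + isFixed ω p ≡ 1
    moved-or-fixed p = trans (+-comm (δ̄ p (o p)) _) (trans (cong (_+ δ̄ p (o p)) (δ-sym (o p) p)) (δ+δ̄≡1 p (o p)))
    inner : ∀ p r → Dec (o r ≡ r) → Dec (p ≡ r) → distinct³ p (o p) r * isFixed ω r ≡ δ̄ p (o p) * isFixed ω r
    inner p r (no or≢r) _ rewrite δ-≢ or≢r = trans (*-zeroʳ (distinct³ p (o p) r)) (sym (*-zeroʳ (δ̄ p (o p))))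
    inner p r (yes or≡r) (yes refl) rewrite or≡r | δ̄-refl p = refl
    inner p r (yes or≡r) (no p≢r)
      rewrite or≡r | δ-refl r | δ̄-≢ p≢r | δ̄-≢ {x = o p} (λ op≡r → p≢r (isPerm⇒injective ω perm (trans op≡r (sym or≡r)))) =
      cong (_* 1) (trans (*-identityʳ (δ̄ p (o p) * 1)) (*-identityʳ (δ̄ p (o p))))
    per-point : ∀ p → ∑[ q ∈ Fn ] ∑[ r ∈ Fn ] (distinct³ p q r * (δ (o p) q * isFixed ω r)) ≡ δ̄ p (o p) * a 1
    per-point p = begin
      ∑[ q ∈ Fn ] ∑[ r ∈ Fn ] (distinct³ p q r * (δ (o p) q * isFixed ω r))
        ≡⟨ ∑-comm Fn Fn (λ q r → distinct³ p q r * (δ (o p) q * isFixed ω r)) ⟩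
      ∑[ r ∈ Fn ] ∑[ q ∈ Fn ] (distinct³ p q r * (δ (o p) q * isFixed ω r))
        ≡⟨ ∑-cong Fn (λ r → trans (∑-cong Fn (λ q → x*yz≡y*xz (distinct³ p q r) (δ (o p) q) (isFixed ω r)))
                                  (∑-δˡ enum (o p) (λ q → distinct³ p q r * isFixed ω r))) ⟩
      ∑[ r ∈ Fn ] (distinct³ p (o p) r * isFixed ω r)
        ≡⟨ ∑-cong Fn (λ r → inner p r (o r ≟ᶠ r) (p ≟ᶠ r)) ⟩
      ∑[ r ∈ Fn ] (δ̄ p (o p) * isFixed ω r)
        ≡⟨ ∑-*ˡ Fn (δ̄ p (o p)) (isFixed ω) ⟩
      δ̄ p (o p) * ∑[ r ∈ Fn ] isFixed ω r
        ≡⟨ cong (δ̄ p (o p) *_) A1 ⟩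
      δ̄ p (o p) * a 1 ∎

  ∑≠³-paths : ∑≠³ (λ p q r → δ (o p) r * δ (o r) q) + a 1 + 2 * a 2 ≡ n
  ∑≠³-paths = begin
    ∑≠³ (λ p q r → δ (o p) r * δ (o r) q) + a 1 + 2 * a 2
      ≡⟨ cong₂ _+_ (cong₂ _+_ (∑-cong Fn per-point) (sym A1)) (sym A2) ⟩
    ∑[ p ∈ Fn ] inLongCycle p + ∑[ p ∈ Fn ] isFixed ω p + ∑[ p ∈ Fn ] isIn2Cycle ω p
      ≡⟨ cong (_+ ∑[ p ∈ Fn ] isIn2Cycle ω p) (sym (∑-+ Fn inLongCycle (isFixed ω))) ⟩
    ∑[ p ∈ Fn ] (inLongCycle p + isFixed ω p) + ∑[ p ∈ Fn ] isIn2Cycle ω p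
      ≡⟨ ∑-+ Fn (λ p → inLongCycle p + isFixed ω p) (isIn2Cycle ω) ⟨
    ∑[ p ∈ Fn ] (inLongCycle p + isFixed ω p + isIn2Cycle ω p)
      ≡⟨ ∑-cong Fn trichotomy ⟩
    ∑[ _ ∈ Fn ] 1
      ≡⟨ trans (∑-allFin-const n 1) (*-identityˡ n) ⟩
    n ∎
    where
    inLongCycle : Fin n → ℕ
    inLongCycle p = δ̄ (o p) p * δ̄ (o (o p)) p
    trichotomy : ∀ p → inLongCycle p + isFixed ω p + isIn2Cycle ω p ≡ 1
    trichotomy p = begin
      δ̄ (o p) p * δ̄ (o (o p)) p + δ (o p) p + δ̄ (o p) p * δ (o (o p)) p
        ≡⟨ regroup (δ̄ (o p) p) (δ̄ (o (o p)) p) (δ (o (o p)) p) (δ (o p) p) ⟩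
      δ̄ (o p) p * (δ (o (o p)) p + δ̄ (o (o p)) p) + δ (o p) p
        ≡⟨ cong (λ z → δ̄ (o p) p * z + δ (o p) p) (δ+δ̄≡1 (o (o p)) p) ⟩
      δ̄ (o p) p * 1 + δ (o p) p
        ≡⟨ trans (cong (_+ δ (o p) p) (*-identityʳ _)) (+-comm (δ̄ (o p) p) _) ⟩
      δ (o p) p + δ̄ (o p) p
        ≡⟨ δ+δ̄≡1 (o p) p ⟩
      1 ∎
      where
      regroup : ∀ x y z w → x * y + w + x * z ≡ x * (z + y) + w
      regroup = solve-∀
    path-end : ∀ p → distinct³ p (o (o p)) (o p) ≡ inLongCycle p
    path-end p = begin
      δ̄ p (o (o p)) * δ̄ p (o p) * δ̄ (o (o p)) (o p)
        ≡⟨ cong₂ (λ u v → δ̄ p (o (o p)) * u * v) (δ̄-sym p (o p)) (δ̄-injective o (isPerm⇒injective ω perm) (o p) p) ⟩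
      δ̄ p (o (o p)) * δ̄ (o p) p * δ̄ (o p) p
        ≡⟨ *-assoc (δ̄ p (o (o p))) (δ̄ (o p) p) (δ̄ (o p) p) ⟩
      δ̄ p (o (o p)) * (δ̄ (o p) p * δ̄ (o p) p)
        ≡⟨ cong₂ _*_ (δ̄-sym p (o (o p))) (δ̄-idem (o p) p) ⟩
      δ̄ (o (o p)) p * δ̄ (o p) p
        ≡⟨ *-comm (δ̄ (o (o p)) p) (δ̄ (o p) p) ⟩
      inLongCycle p ∎
    per-point : ∀ p → ∑[ q ∈ Fn ] ∑[ r ∈ Fn ] (distinct³ p q r * (δ (o p) r * δ (o r) q)) ≡ inLongCycle p
    per-point p = begin
      ∑[ q ∈ Fn ] ∑[ r ∈ Fn ] (distinct³ p q r * (δ (o p) r * δ (o r) q))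
        ≡⟨ ∑-comm Fn Fn (λ q r → distinct³ p q r * (δ (o p) r * δ (o r) q)) ⟩
      ∑[ r ∈ Fn ] ∑[ q ∈ Fn ] (distinct³ p q r * (δ (o p) r * δ (o r) q))
        ≡⟨ ∑-cong Fn (λ r → trans (∑-cong Fn (λ q → x*yz≡z*xy (distinct³ p q r) (δ (o p) r) (δ (o r) q)))
                                  (∑-δˡ enum (o r) (λ q → distinct³ p q r * δ (o p) r))) ⟩
      ∑[ r ∈ Fn ] (distinct³ p (o r) r * δ (o p) r)
        ≡⟨ ∑-cong Fn (λ r → *-comm (distinct³ p (o r) r) (δ (o p) r)) ⟩
      ∑[ r ∈ Fn ] (δ (o p) r * distinct³ p (o r) r)
        ≡⟨ ∑-δˡ enum (o p) (λ r → distinct³ p (o r) r) ⟩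
      distinct³ p (o (o p)) (o p)
        ≡⟨ path-end p ⟩
      inLongCycle p ∎

module PatternCounts (m : ℕ) (a : ℕ → ℕ) where
  open ≡-Reasoning

  n : ℕ
  n = suc (suc (suc m))

  open ClassSum n a public

  #[_↦_,_↦_] : Fin n → Fin n → Fin n → Fin n → ℕ
  #[ u₁ ↦ v₁ , u₂ ↦ v₂ ] = ∑ᶜ[ ω ] (δ (lookup ω u₁) v₁ * δ (lookup ω u₂) v₂)

  #-transpose : ∀ x y u₁ v₁ u₂ v₂ → let τ = transpose x y in
                #[ τ u₁ ↦ τ v₁ , τ u₂ ↦ τ v₂ ] ≡ #[ u₁ ↦ v₁ , u₂ ↦ v₂ ]
  #-transpose x y u₁ v₁ u₂ v₂ = trans (sym (∑ᶜ-conjugate x y _)) (∑ᶜ-cong λ ω → cong₂ _*_ (δ-conj ω u₁ v₁) (δ-conj ω u₂ v₂))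
    where
    δ-conj : ∀ ω u v → δ (lookup (conjugate x y ω) (transpose x y u)) (transpose x y v) ≡ δ (lookup ω u) v
    δ-conj ω u v = trans (cong (λ z → δ z (transpose x y v)) (lookup-conjugate-τ x y ω u))
                         (δ-injective (transpose x y) (transpose-injective x y) (lookup ω u) v)

  class-size : ℕ
  class-size = ∑ᶜ[ _ ] 1

  0F 1F 2F : Fin n
  0F = zero
  1F = suc zero
  2F = suc (suc zero)

  0≢1 : 0F ≢ 1F
  0≢1 ()
  0≢2 : 0F ≢ 2F
  0≢2 ()
  1≢2 : 1F ≢ 2F
  1≢2 ()

  fix² swap² mapFix³ path³ : ℕ
  fix² = #[ 0F ↦ 0F , 1F ↦ 1F ]
  swap² = #[ 0F ↦ 1F , 1F ↦ 0F ]
  mapFix³ = #[ 0F ↦ 1F , 2F ↦ 2F ]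
  path³ = #[ 0F ↦ 2F , 2F ↦ 1F ]

  module _ {p r : Fin n} (p≢r : p ≢ r) where

    fix²-const : #[ p ↦ p , r ↦ r ] ≡ fix²
    fix²-const = transpose-invariant²⇒const (λ p r → #[ p ↦ p , r ↦ r ]) (λ x y p r → #-transpose x y p p r r) p≢r 0≢1

    swap²-const : #[ p ↦ r , r ↦ p ] ≡ swap²
    swap²-const = transpose-invariant²⇒const (λ p r → #[ p ↦ r , r ↦ p ]) (λ x y p r → #-transpose x y p r r p) p≢r 0≢1

  module _ {p q r : Fin n} (p≢q : p ≢ q) (p≢r : p ≢ r) (q≢r : q ≢ r) where

    mapFix³-const : #[ p ↦ q , r ↦ r ] ≡ mapFix³
    mapFix³-const = transpose-invariant³⇒const (λ p q r → #[ p ↦ q , r ↦ r ]) (λ x y p q r → #-transpose x y p q r r)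
                      p≢q p≢r q≢r 0≢1 0≢2 1≢2

    path³-const : #[ p ↦ r , r ↦ q ] ≡ path³
    path³-const = transpose-invariant³⇒const (λ p q r → #[ p ↦ r , r ↦ q ]) (λ x y p q r → #-transpose x y p r r q)
                    p≢q p≢r q≢r 0≢1 0≢2 1≢2

  ∑≠²-∑ᶜ : ∀ (f : Fin n → Fin n → Vec (Fin n) n → ℕ) → ∑≠² (λ p r → ∑ᶜ (f p r)) ≡ ∑ᶜ[ ω ] ∑≠² (λ p r → f p r ω)
  ∑≠²-∑ᶜ f = sym (begin
    ∑ᶜ[ ω ] ∑≠² (λ p r → f p r ω)
      ≡⟨ ∑ᶜ-∑ (allFin n) _ ⟩
    ∑[ p ∈ allFin n ] ∑ᶜ[ ω ] ∑[ r ∈ allFin n ] (δ̄ p r * f p r ω)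
      ≡⟨ ∑-cong (allFin n) (λ p → ∑ᶜ-∑ (allFin n) _) ⟩
    ∑[ p ∈ allFin n ] ∑[ r ∈ allFin n ] ∑ᶜ[ ω ] (δ̄ p r * f p r ω)
      ≡⟨ ∑-cong (allFin n) (λ p → ∑-cong (allFin n) (λ r → ∑ᶜ-*ˡ (δ̄ p r) (f p r))) ⟩
    ∑≠² (λ p r → ∑ᶜ (f p r))                                    ∎)

  ∑≠³-∑ᶜ : ∀ (f : Fin n → Fin n → Fin n → Vec (Fin n) n → ℕ) →
           ∑≠³ (λ p q r → ∑ᶜ (f p q r)) ≡ ∑ᶜ[ ω ] ∑≠³ (λ p q r → f p q r ω)
  ∑≠³-∑ᶜ f = sym (begin
    ∑ᶜ[ ω ] ∑≠³ (λ p q r → f p q r ω)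
      ≡⟨ ∑ᶜ-∑ Fn _ ⟩
    ∑[ p ∈ Fn ] ∑ᶜ[ ω ] ∑[ q ∈ Fn ] ∑[ r ∈ Fn ] (distinct³ p q r * f p q r ω)
      ≡⟨ ∑-cong Fn (λ p → ∑ᶜ-∑ Fn _) ⟩
    ∑[ p ∈ Fn ] ∑[ q ∈ Fn ] ∑ᶜ[ ω ] ∑[ r ∈ Fn ] (distinct³ p q r * f p q r ω)
      ≡⟨ ∑-cong Fn (λ p → ∑-cong Fn (λ q → ∑ᶜ-∑ Fn _)) ⟩
    ∑[ p ∈ Fn ] ∑[ q ∈ Fn ] ∑[ r ∈ Fn ] ∑ᶜ[ ω ] (distinct³ p q r * f p q r ω)
      ≡⟨ ∑-cong Fn (λ p → ∑-cong Fn (λ q → ∑-cong Fn (λ r → ∑ᶜ-*ˡ (distinct³ p q r) (f p q r)))) ⟩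
    ∑≠³ (λ p q r → ∑ᶜ (f p q r)) ∎)
    where Fn = allFin n

  fix²-count : fix² * (n * suc (suc m)) ≡ a 1 * (a 1 ∸ 1) * class-size
  fix²-count = begin
    fix² * (n * suc (suc m))                                  ≡⟨ ∑≠²-const (λ p r → #[ p ↦ p , r ↦ r ]) fix² fix²-const ⟨
    ∑≠² (λ p r → #[ p ↦ p , r ↦ r ])                          ≡⟨ ∑≠²-∑ᶜ (λ p r ω → isFixed ω p * isFixed ω r) ⟩
    ∑ᶜ[ ω ] ∑≠² (λ p r → isFixed ω p * isFixed ω r)           ≡⟨ ∑ᶜ-cong-Class (∑≠²-fixed-fixed a) ⟩
    ∑ᶜ[ _ ] (a 1 * (a 1 ∸ 1))                                 ≡⟨ ∑ᶜ-const (a 1 * (a 1 ∸ 1)) ⟩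
    a 1 * (a 1 ∸ 1) * class-size                              ∎

  swap²-count : swap² * (n * suc (suc m)) ≡ 2 * a 2 * class-size
  swap²-count = begin
    swap² * (n * suc (suc m))                                  ≡⟨ ∑≠²-const (λ p r → #[ p ↦ r , r ↦ p ]) swap² swap²-const ⟨
    ∑≠² (λ p r → #[ p ↦ r , r ↦ p ])                           ≡⟨ ∑≠²-∑ᶜ (λ p r ω → δ (lookup ω p) r * δ (lookup ω r) p) ⟩
    ∑ᶜ[ ω ] ∑≠² (λ p r → δ (lookup ω p) r * δ (lookup ω r) p)  ≡⟨ ∑ᶜ-cong-Class (∑≠²-swapped a) ⟩
    ∑ᶜ[ _ ] (2 * a 2)                                          ≡⟨ ∑ᶜ-const (2 * a 2) ⟩
    2 * a 2 * class-size                                       ∎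

  mapFix³-count : mapFix³ * (n * suc (suc m) * suc m) + a 1 * a 1 * class-size ≡ n * a 1 * class-size
  mapFix³-count = begin
    mapFix³ * (n * suc (suc m) * suc m) + a 1 * a 1 * class-size
      ≡⟨ cong₂ _+_ (∑≠³-const (λ p q r → #[ p ↦ q , r ↦ r ]) mapFix³ mapFix³-const) (∑ᶜ-const (a 1 * a 1)) ⟨
    ∑≠³ (λ p q r → #[ p ↦ q , r ↦ r ]) + ∑ᶜ[ _ ] (a 1 * a 1)
      ≡⟨ cong (_+ ∑ᶜ[ _ ] (a 1 * a 1)) (∑≠³-∑ᶜ (λ p q r ω → δ (lookup ω p) q * isFixed ω r)) ⟩
    ∑ᶜ[ ω ] ∑≠³ (λ p q r → δ (lookup ω p) q * isFixed ω r) + ∑ᶜ[ _ ] (a 1 * a 1)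
      ≡⟨ ∑ᶜ-+ (λ ω → ∑≠³ (λ p q r → δ (lookup ω p) q * isFixed ω r)) (λ _ → a 1 * a 1) ⟨
    ∑ᶜ[ ω ] (∑≠³ (λ p q r → δ (lookup ω p) q * isFixed ω r) + a 1 * a 1)
      ≡⟨ ∑ᶜ-cong-Class (∑≠³-maps-fixed a) ⟩
    ∑ᶜ[ _ ] (n * a 1)
      ≡⟨ ∑ᶜ-const (n * a 1) ⟩
    n * a 1 * class-size ∎

  path³-count : path³ * (n * suc (suc m) * suc m) + a 1 * class-size + 2 * a 2 * class-size ≡ n * class-size
  path³-count = begin
    path³ * (n * suc (suc m) * suc m) + a 1 * class-size + 2 * a 2 * class-size
      ≡⟨ cong₂ _+_ (cong₂ _+_ (∑≠³-const (λ p q r → #[ p ↦ r , r ↦ q ]) path³ path³-const) (∑ᶜ-const (a 1))) (∑ᶜ-const (2 * a 2)) ⟨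
    ∑≠³ (λ p q r → #[ p ↦ r , r ↦ q ]) + ∑ᶜ[ _ ] a 1 + ∑ᶜ[ _ ] (2 * a 2)
      ≡⟨ cong (λ z → z + ∑ᶜ[ _ ] a 1 + ∑ᶜ[ _ ] (2 * a 2)) (∑≠³-∑ᶜ (λ p q r ω → δ (lookup ω p) r * δ (lookup ω r) q)) ⟩
    ∑ᶜ[ ω ] ∑≠³ (λ p q r → δ (lookup ω p) r * δ (lookup ω r) q) + ∑ᶜ[ _ ] a 1 + ∑ᶜ[ _ ] (2 * a 2)
      ≡⟨ trans (cong (_+ ∑ᶜ[ _ ] (2 * a 2)) (sym (∑ᶜ-+ paths (λ _ → a 1)))) (sym (∑ᶜ-+ (λ ω → paths ω + a 1) (λ _ → 2 * a 2))) ⟩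
    ∑ᶜ[ ω ] (∑≠³ (λ p q r → δ (lookup ω p) r * δ (lookup ω r) q) + a 1 + 2 * a 2)
      ≡⟨ ∑ᶜ-cong-Class (∑≠³-paths a) ⟩
    ∑ᶜ[ _ ] n
      ≡⟨ ∑ᶜ-const n ⟩
    n * class-size ∎
    where
    paths : Vec (Fin n) n → ℕ
    paths ω = ∑≠³ (λ p q r → δ (lookup ω p) r * δ (lookup ω r) q)

-- Inversions

<ᵇ-irrefl : ∀ x → (x <ᵇ x) ≡ false
<ᵇ-irrefl zero = refl
<ᵇ-irrefl (suc x) = <ᵇ-irrefl x

<ᵇ-suc : ∀ x → (x <ᵇ suc x) ≡ true
<ᵇ-suc zero = refl
<ᵇ-suc (suc x) = <ᵇ-suc x

suc-<ᵇ : ∀ x → (suc x <ᵇ x) ≡ false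
suc-<ᵇ zero = refl
suc-<ᵇ (suc x) = suc-<ᵇ x

suc-<ᵇ-apart : ∀ t x → x ≢ t → x ≢ suc t → (suc t <ᵇ x) ≡ (t <ᵇ x)
suc-<ᵇ-apart t zero _ _ = refl
suc-<ᵇ-apart zero (suc zero) _ x≢1 = ⊥-elim (x≢1 refl)
suc-<ᵇ-apart zero (suc (suc x)) _ _ = refl
suc-<ᵇ-apart (suc t) (suc x) x≢t x≢1+t = suc-<ᵇ-apart t x (x≢t ∘ cong suc) (x≢1+t ∘ cong suc)

<ᵇ-suc-apart : ∀ t x → x ≢ t → x ≢ suc t → (x <ᵇ suc t) ≡ (x <ᵇ t)
<ᵇ-suc-apart zero zero x≢0 _ = ⊥-elim (x≢0 refl)
<ᵇ-suc-apart zero (suc x) _ _ = refl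
<ᵇ-suc-apart (suc t) zero _ _ = refl
<ᵇ-suc-apart (suc t) (suc x) x≢t x≢1+t = <ᵇ-suc-apart t x (x≢t ∘ cong suc) (x≢1+t ∘ cong suc)

less : ∀ {n} → Fin n → Fin n → ℕ
less u v = ⟦ toℕ u <ᵇ toℕ v ⟧

less-total : ∀ {n} {x y : Fin n} → x ≢ y → less x y + less y x ≡ 1
less-total {x = x} {y} x≢y = go (toℕ x) (toℕ y) (x≢y ∘ toℕ-injective)
  where
  go : ∀ a b → a ≢ b → ⟦ a <ᵇ b ⟧ + ⟦ b <ᵇ a ⟧ ≡ 1
  go zero zero 0≢0 = ⊥-elim (0≢0 refl)
  go zero (suc b) _ = refl
  go (suc a) zero _ = refl
  go (suc a) (suc b) a≢b = go a b (a≢b ∘ cong suc)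

-- Exchanging the adjacent values j and j′ = j + 1 reverses the relative order of u and v
-- exactly when {u, v} = {j, j′}.
module _ {n} {j j′ : Fin n} (j′≡1+j : toℕ j′ ≡ suc (toℕ j)) where
  private
    τ : Fin n → Fin n
    τ = transpose j j′
    j≢j′ : j ≢ j′
    j≢j′ e = 1+n≢n (trans (sym j′≡1+j) (cong toℕ (sym e)))
    j′≢j : j′ ≢ j
    j′≢j = j≢j′ ∘ sym
    toℕ-≢ : ∀ {v} → v ≢ j → toℕ v ≢ toℕ j
    toℕ-≢ v≢j = v≢j ∘ toℕ-injective
    toℕ-≢′ : ∀ {v} → v ≢ j′ → toℕ v ≢ suc (toℕ j)
    toℕ-≢′ v≢j′ e = v≢j′ (toℕ-injective (trans e (sym j′≡1+j)))

  less-transpose-adjacent : ∀ u v → less (τ u) (τ v) + δ u j * δ v j′ ≡ less u v + δ u j′ * δ v j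
  less-transpose-adjacent u v = go (u ≟ᶠ j) (u ≟ᶠ j′) (v ≟ᶠ j) (v ≟ᶠ j′)
    where
    go : Dec (u ≡ j) → Dec (u ≡ j′) → Dec (v ≡ j) → Dec (v ≡ j′) →
         less (τ u) (τ v) + δ u j * δ v j′ ≡ less u v + δ u j′ * δ v j
    go (yes refl) _ (yes refl) _
      rewrite transpose-matchˡ u j′ | δ-refl u | δ-≢ j≢j′ | <ᵇ-irrefl (toℕ j′) | <ᵇ-irrefl (toℕ u) = refl
    go (yes refl) _ (no _) (yes refl)
      rewrite transpose-matchˡ u v | transpose-matchʳ u v | δ-refl u | δ-refl v | δ-≢ j≢j′ | j′≡1+j
            | suc-<ᵇ (toℕ u) | <ᵇ-suc (toℕ u) = refl
    go (yes refl) _ (no v≢j) (no v≢j′)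
      rewrite transpose-matchˡ u j′ | transpose-other u j′ v≢j v≢j′ | δ-refl u | δ-≢ v≢j′ | δ-≢ v≢j | δ-≢ j≢j′ | j′≡1+j
      = cong (λ z → ⟦ z ⟧ + 0) (suc-<ᵇ-apart (toℕ u) (toℕ v) (toℕ-≢ v≢j) (toℕ-≢′ v≢j′))
    go (no _) (yes refl) (yes refl) _
      rewrite transpose-matchʳ v u | transpose-matchˡ v u | δ-refl u | δ-refl v | δ-≢ j≢j′ | δ-≢ j′≢j | j′≡1+j
            | suc-<ᵇ (toℕ v) | <ᵇ-suc (toℕ v) = refl
    go (no _) (yes refl) (no _) (yes refl)
      rewrite transpose-matchʳ j u | δ-refl u | δ-≢ j′≢j | <ᵇ-irrefl (toℕ j) | <ᵇ-irrefl (toℕ u) = refl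
    go (no _) (yes refl) (no v≢j) (no v≢j′)
      rewrite transpose-matchʳ j u | transpose-other j u v≢j v≢j′ | δ-refl u | δ-≢ v≢j′ | δ-≢ v≢j | δ-≢ j′≢j | j′≡1+j
      = cong (λ z → ⟦ z ⟧ + 0) (sym (suc-<ᵇ-apart (toℕ j) (toℕ v) (toℕ-≢ v≢j) (toℕ-≢′ v≢j′)))
    go (no u≢j) (no u≢j′) (yes refl) _
      rewrite transpose-matchˡ v j′ | transpose-other v j′ u≢j u≢j′ | δ-refl v | δ-≢ u≢j′ | δ-≢ u≢j | j′≡1+j
      = cong (λ z → ⟦ z ⟧ + 0) (<ᵇ-suc-apart (toℕ v) (toℕ u) (toℕ-≢ u≢j) (toℕ-≢′ u≢j′))
    go (no u≢j) (no u≢j′) (no _) (yes refl)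
      rewrite transpose-matchʳ j v | transpose-other j v u≢j u≢j′ | δ-refl v | δ-≢ u≢j′ | δ-≢ u≢j | j′≡1+j
      = cong (λ z → ⟦ z ⟧ + 0) (sym (<ᵇ-suc-apart (toℕ j) (toℕ u) (toℕ-≢ u≢j) (toℕ-≢′ u≢j′)))
    go (no u≢j) (no u≢j′) (no v≢j) (no v≢j′)
      rewrite transpose-other j j′ u≢j u≢j′ | transpose-other j j′ v≢j v≢j′ | δ-≢ u≢j | δ-≢ u≢j′ = refl

module InversionCounts (m : ℕ) (a : ℕ → ℕ) where
  open PatternCounts m a
  open ≡-Reasoning

  inversions : Fin n → Fin n → ℕ
  inversions i j = ∑ᶜ[ ω ] ⟦ I i j ω ⟧

  inversions-adjacent : ∀ {i i⁺} → toℕ i⁺ ≡ suc (toℕ i) →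
    inversions i i⁺ + inversions i i⁺ + #[ i ↦ i , i⁺ ↦ i⁺ ] ≡ class-size + #[ i ↦ i⁺ , i⁺ ↦ i ]
  inversions-adjacent {i} {i⁺} i⁺≡1+i = begin
    inversions i i⁺ + inversions i i⁺ + #[ i ↦ i , i⁺ ↦ i⁺ ]
      ≡⟨ cong (λ z → z + inversions i i⁺ + #[ i ↦ i , i⁺ ↦ i⁺ ]) (∑ᶜ-conjugate i i⁺ (λ ω → ⟦ I i i⁺ ω ⟧)) ⟨
    ∑ᶜ[ ω ] ⟦ I i i⁺ (conjugate i i⁺ ω) ⟧ + inversions i i⁺ + #[ i ↦ i , i⁺ ↦ i⁺ ]
      ≡⟨ cong (_+ #[ i ↦ i , i⁺ ↦ i⁺ ]) (∑ᶜ-+ (λ ω → ⟦ I i i⁺ (conjugate i i⁺ ω) ⟧) (λ ω → ⟦ I i i⁺ ω ⟧)) ⟨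
    ∑ᶜ[ ω ] (⟦ I i i⁺ (conjugate i i⁺ ω) ⟧ + ⟦ I i i⁺ ω ⟧) + #[ i ↦ i , i⁺ ↦ i⁺ ]
      ≡⟨ ∑ᶜ-+ (λ ω → ⟦ I i i⁺ (conjugate i i⁺ ω) ⟧ + ⟦ I i i⁺ ω ⟧) _ ⟨
    ∑ᶜ[ ω ] (⟦ I i i⁺ (conjugate i i⁺ ω) ⟧ + ⟦ I i i⁺ ω ⟧ + δ (lookup ω i) i * δ (lookup ω i⁺) i⁺)
      ≡⟨ ∑ᶜ-cong-Class per-permutation ⟩
    ∑ᶜ[ ω ] (1 + δ (lookup ω i) i⁺ * δ (lookup ω i⁺) i)
      ≡⟨ ∑ᶜ-+ (λ _ → 1) _ ⟩
    class-size + #[ i ↦ i⁺ , i⁺ ↦ i ] ∎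
    where
    τ : Fin n → Fin n
    τ = transpose i i⁺
    i≢i⁺ : i ≢ i⁺
    i≢i⁺ e = 1+n≢n (trans (sym i⁺≡1+i) (cong toℕ (sym e)))
    per-permutation : ∀ ω → isPerm ω ≡ true → hasCycleType a ω ≡ true →
      ⟦ I i i⁺ (conjugate i i⁺ ω) ⟧ + ⟦ I i i⁺ ω ⟧ + δ (lookup ω i) i * δ (lookup ω i⁺) i⁺ ≡
      1 + δ (lookup ω i) i⁺ * δ (lookup ω i⁺) i
    per-permutation ω perm _ = begin
      ⟦ I i i⁺ (conjugate i i⁺ ω) ⟧ + less v u + δ u i * δ v i⁺ ≡⟨ cong (λ z → ⟦ z ⟧ + less v u + δ u i * δ v i⁺) conj-order ⟩
      less (τ u) (τ v) + less v u + δ u i * δ v i⁺           ≡⟨ x+y+z≡x+z+y (less (τ u) (τ v)) (less v u) _ ⟩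
      less (τ u) (τ v) + δ u i * δ v i⁺ + less v u           ≡⟨ cong (_+ less v u) (less-transpose-adjacent i⁺≡1+i u v) ⟩
      less u v + δ u i⁺ * δ v i + less v u                   ≡⟨ x+y+z≡x+z+y (less u v) (δ u i⁺ * δ v i) _ ⟩
      less u v + less v u + δ u i⁺ * δ v i                   ≡⟨ cong (_+ δ u i⁺ * δ v i) (less-total (i≢i⁺ ∘ isPerm⇒injective ω perm)) ⟩
      1 + δ u i⁺ * δ v i                                     ∎
      where
      u v : Fin n
      u = lookup ω i
      v = lookup ω i⁺
      conj-order : I i i⁺ (conjugate i i⁺ ω) ≡ (toℕ (τ u) <ᵇ toℕ (τ v))
      conj-order = cong₂ (λ x y → toℕ x <ᵇ toℕ y)
        (trans (lookup-conjugate i i⁺ ω i⁺) (cong (τ ∘ lookup ω) (transpose-matchʳ i i⁺)))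
        (trans (lookup-conjugate i i⁺ ω i) (cong (τ ∘ lookup ω) (transpose-matchˡ i i⁺)))
      x+y+z≡x+z+y : ∀ x y z → x + y + z ≡ x + z + y
      x+y+z≡x+z+y = solve-∀

  inversions-step : ∀ {i j j⁺} → toℕ j⁺ ≡ suc (toℕ j) → i ≢ j → i ≢ j⁺ →
    inversions i j + #[ i ↦ j⁺ , j⁺ ↦ j ] ≡ inversions i j⁺ + #[ i ↦ j , j⁺ ↦ j⁺ ]
  inversions-step {i} {j} {j⁺} j⁺≡1+j i≢j i≢j⁺ = begin
    inversions i j + #[ i ↦ j⁺ , j⁺ ↦ j ]
      ≡⟨ cong (_+ #[ i ↦ j⁺ , j⁺ ↦ j ]) (∑ᶜ-conjugate j j⁺ (λ ω → ⟦ I i j ω ⟧)) ⟨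
    ∑ᶜ[ ω ] ⟦ I i j (conjugate j j⁺ ω) ⟧ + #[ i ↦ j⁺ , j⁺ ↦ j ]
      ≡⟨ ∑ᶜ-+ (λ ω → ⟦ I i j (conjugate j j⁺ ω) ⟧) _ ⟨
    ∑ᶜ[ ω ] (⟦ I i j (conjugate j j⁺ ω) ⟧ + δ (lookup ω i) j⁺ * δ (lookup ω j⁺) j)
      ≡⟨ ∑ᶜ-cong per-permutation ⟩
    ∑ᶜ[ ω ] (⟦ I i j⁺ ω ⟧ + δ (lookup ω i) j * δ (lookup ω j⁺) j⁺)
      ≡⟨ ∑ᶜ-+ (λ ω → ⟦ I i j⁺ ω ⟧) _ ⟩
    inversions i j⁺ + #[ i ↦ j , j⁺ ↦ j⁺ ] ∎
    where
    τ : Fin n → Fin n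
    τ = transpose j j⁺
    per-permutation : ∀ ω → ⟦ I i j (conjugate j j⁺ ω) ⟧ + δ (lookup ω i) j⁺ * δ (lookup ω j⁺) j ≡
                            ⟦ I i j⁺ ω ⟧ + δ (lookup ω i) j * δ (lookup ω j⁺) j⁺
    per-permutation ω = begin
      ⟦ I i j (conjugate j j⁺ ω) ⟧ + δ v j⁺ * δ u j ≡⟨ cong₂ (λ z w → ⟦ z ⟧ + w) conj-order (*-comm (δ v j⁺) (δ u j)) ⟩
      less (τ u) (τ v) + δ u j * δ v j⁺             ≡⟨ less-transpose-adjacent j⁺≡1+j u v ⟩
      less u v + δ u j⁺ * δ v j                     ≡⟨ cong (less u v +_) (*-comm (δ u j⁺) (δ v j)) ⟩
      less u v + δ v j * δ u j⁺                     ∎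
      where
      u v : Fin n
      u = lookup ω j⁺
      v = lookup ω i
      conj-order : I i j (conjugate j j⁺ ω) ≡ (toℕ (τ u) <ᵇ toℕ (τ v))
      conj-order = cong₂ (λ x y → toℕ x <ᵇ toℕ y)
        (trans (lookup-conjugate j j⁺ ω j) (cong (τ ∘ lookup ω) (transpose-matchˡ j j⁺)))
        (trans (lookup-conjugate j j⁺ ω i) (cong (τ ∘ lookup ω) (transpose-other j j⁺ i≢j i≢j⁺)))

  inversions-shift : ∀ {i i⁺} → toℕ i⁺ ≡ suc (toℕ i) → ∀ d {j} → toℕ j ≡ toℕ i⁺ + d →
    inversions i j + d * mapFix³ ≡ inversions i i⁺ + d * path³
  inversions-shift {i} {i⁺} i⁺≡1+i zero j≡ = cong (λ z → inversions i z + 0) (toℕ-injective (trans j≡ (+-identityʳ _)))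
  inversions-shift {i} {i⁺} i⁺≡1+i (suc d) {j} j≡ = begin
    inversions i j + (mapFix³ + d * mapFix³)         ≡⟨ +-assoc (inversions i j) mapFix³ (d * mapFix³) ⟨
    inversions i j + mapFix³ + d * mapFix³           ≡⟨ cong (λ z → inversions i j + z + d * mapFix³) (mapFix³-const i≢j₀ i≢j j₀≢j) ⟨
    inversions i j + #[ i ↦ j₀ , j ↦ j ] + d * mapFix³ ≡⟨ cong (_+ d * mapFix³) (inversions-step j≡1+j₀ i≢j₀ i≢j) ⟨
    inversions i j₀ + #[ i ↦ j , j ↦ j₀ ] + d * mapFix³ ≡⟨ cong (λ z → inversions i j₀ + z + d * mapFix³) (path³-const i≢j₀ i≢j j₀≢j) ⟩
    inversions i j₀ + path³ + d * mapFix³            ≡⟨ x+y+z≡x+z+y (inversions i j₀) path³ (d * mapFix³) ⟩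
    inversions i j₀ + d * mapFix³ + path³            ≡⟨ cong (_+ path³) (inversions-shift i⁺≡1+i d (toℕ-fromℕ< j₀<n)) ⟩
    inversions i i⁺ + d * path³ + path³              ≡⟨ x+y+z≡x+z+y (inversions i i⁺) (d * path³) path³ ⟩
    inversions i i⁺ + path³ + d * path³              ≡⟨ +-assoc (inversions i i⁺) path³ (d * path³) ⟩
    inversions i i⁺ + (path³ + d * path³)            ∎
    where
    x+y+z≡x+z+y : ∀ x y z → x + y + z ≡ x + z + y
    x+y+z≡x+z+y = solve-∀
    j₀<n : toℕ i⁺ + d < n
    j₀<n = <-trans (n<1+n (toℕ i⁺ + d)) (subst (_< n) (trans j≡ (+-suc (toℕ i⁺) d)) (toℕ<n j))
    j₀ : Fin n
    j₀ = fromℕ< j₀<n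
    j≡1+j₀ : toℕ j ≡ suc (toℕ j₀)
    j≡1+j₀ = trans j≡ (trans (+-suc (toℕ i⁺) d) (cong suc (sym (toℕ-fromℕ< j₀<n))))
    i<j₀ : toℕ i < toℕ j₀
    i<j₀ = subst (toℕ i <_) (sym (toℕ-fromℕ< j₀<n)) (≤-trans (≤-reflexive (sym i⁺≡1+i)) (m≤m+n (toℕ i⁺) d))
    i≢j₀ : i ≢ j₀
    i≢j₀ e = <-irrefl (cong toℕ e) i<j₀
    i≢j : i ≢ j
    i≢j e = <-irrefl (cong toℕ e) (<-trans i<j₀ (≤-reflexive (sym j≡1+j₀)))
    j₀≢j : j₀ ≢ j
    j₀≢j e = 1+n≢n (sym (trans (cong toℕ e) j≡1+j₀))

-- A permutation of every cycle type

fold-suc : ∀ (x : A) f k → fold x f (suc k) ≡ fold (f x) f k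
fold-suc x f k = trans (cong (fold x f) (+-comm 1 k)) (fold-+ x f k)

module _ (q : ℕ) .{{_ : NonZero q}} where
  open ≡-Reasoning

  rotateℕ : ℕ → ℕ
  rotateℕ t = suc t % q

  fold-rotateℕ : ∀ k {t} → t < q → fold t rotateℕ k ≡ (t + k) % q
  fold-rotateℕ zero {t} t<q = sym (trans (cong (_% q) (+-identityʳ t)) (m<n⇒m%n≡m t<q))
  fold-rotateℕ (suc k) {t} t<q = begin
    suc (fold t rotateℕ k) % q     ≡⟨ cong (λ z → suc z % q) (fold-rotateℕ k t<q) ⟩
    (1 + (t + k) % q) % q          ≡⟨ %-distribˡ-+ 1 ((t + k) % q) q ⟩
    (1 % q + (t + k) % q % q) % q  ≡⟨ cong (λ z → (1 % q + z) % q) (m%n%n≡m%n (t + k) q) ⟩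
    (1 % q + (t + k) % q) % q      ≡⟨ %-distribˡ-+ 1 (t + k) q ⟨
    suc (t + k) % q                ≡⟨ cong (_% q) (+-suc t k) ⟨
    (t + suc k) % q                ∎

  fold-rotateℕ-period : ∀ {t} → t < q → fold t rotateℕ q ≡ t
  fold-rotateℕ-period {t} t<q = trans (fold-rotateℕ q t<q) (trans ([m+n]%n≡m%n t q) (m<n⇒m%n≡m t<q))

  fold-rotateℕ-aperiodic : ∀ {t k} → t < q → 0 < k → k < q → fold t rotateℕ k ≢ t
  fold-rotateℕ-aperiodic {t} {k} t<q 0<k k<q e with t + k <? q
  ... | yes t+k<q = <-irrefl (sym (+-cancelˡ-≡ t k 0 (trans t+k≡t (sym (+-identityʳ t))))) 0<k
    where
    t+k≡t : t + k ≡ t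
    t+k≡t = trans (sym (m<n⇒m%n≡m t+k<q)) (trans (sym (fold-rotateℕ k t<q)) e)
  ... | no t+k≮q = <-irrefl (+-cancelˡ-≡ t k q (sym t+q≡t+k)) k<q
    where
    q≤t+k : q ≤ t + k
    q≤t+k = ≮⇒≥ t+k≮q
    wrapped : t + k ∸ q ≡ t
    wrapped = trans (sym (m<n⇒m%n≡m (m<n+o⇒m∸n<o (t + k) q (+-mono-< t<q k<q))))
                    (trans (m≤n⇒[n∸m]%m≡n%m q≤t+k) (trans (sym (fold-rotateℕ k t<q)) e))
    t+q≡t+k : t + q ≡ t + k
    t+q≡t+k = trans (cong (_+ q) (sym wrapped)) (m∸n+n≡m q≤t+k)

firstReturnF : ∀ {N} → (Fin N → Fin N) → Fin N → ℕ → ℕ → ℕ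
firstReturnF g x k zero = 0
firstReturnF g x k (suc fuel) = if ⌊ fold x g k ≟ᶠ x ⌋ then k else firstReturnF g x (suc k) fuel

firstReturn-tabulate : ∀ {N} (g : Fin N → Fin N) x k fuel → firstReturn (tabulate g) x k fuel ≡ firstReturnF g x k fuel
firstReturn-tabulate g x k zero = refl
firstReturn-tabulate g x k (suc fuel) =
  cong₂ (λ b r → if b then k else r) (cong (λ z → ⌊ z ≟ᶠ x ⌋) (iter-tabulate k)) (firstReturn-tabulate g x (suc k) fuel)
  where
  iter-tabulate : ∀ k → iter (tabulate g) k x ≡ fold x g k
  iter-tabulate zero = refl
  iter-tabulate (suc k) = trans (lookup∘tabulate g _) (cong g (iter-tabulate k))

firstReturnF-fuel : ∀ {N} (g : Fin N → Fin N) x k fuel extra →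
  firstReturnF g x k fuel ≢ 0 → firstReturnF g x k (fuel + extra) ≡ firstReturnF g x k fuel
firstReturnF-fuel g x k zero extra none = ⊥-elim (none refl)
firstReturnF-fuel g x k (suc fuel) extra none with ⌊ fold x g k ≟ᶠ x ⌋
... | true = refl
... | false = firstReturnF-fuel g x (suc k) fuel extra none

module _ (p : ℕ) where
  private
    q : ℕ
    q = suc p

  rotate : Fin q → Fin q
  rotate i = suc (toℕ i) mod q

  toℕ-fold-rotate : ∀ k i → toℕ (fold i rotate k) ≡ fold (toℕ i) (rotateℕ q) k
  toℕ-fold-rotate zero i = refl
  toℕ-fold-rotate (suc k) i = trans (toℕ-fromℕ< (m%n<n (suc (toℕ (fold i rotate k))) q)) (cong (rotateℕ q) (toℕ-fold-rotate k i))

  fold-rotate-period : ∀ i → fold i rotate q ≡ i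
  fold-rotate-period i = toℕ-injective (trans (toℕ-fold-rotate q i) (fold-rotateℕ-period q (toℕ<n i)))

  rotate-injective : ∀ {i j} → rotate i ≡ rotate j → i ≡ j
  rotate-injective {i} {j} e = begin
    i                            ≡⟨ trans (sym (fold-rotate-period i)) (fold-suc i rotate p) ⟩
    fold (rotate i) rotate p     ≡⟨ cong (λ z → fold z rotate p) e ⟩
    fold (rotate j) rotate p     ≡⟨ trans (sym (fold-suc j rotate p)) (fold-rotate-period j) ⟩
    j                            ∎
    where open ≡-Reasoning

  fold-rotate-aperiodic : ∀ {k} i → 0 < k → k < q → fold i rotate k ≢ i
  fold-rotate-aperiodic {k} i 0<k k<q e =
    fold-rotateℕ-aperiodic q (toℕ<n i) 0<k k<q (trans (sym (toℕ-fold-rotate k i)) (cong toℕ e))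

  firstReturnF-rotate : ∀ i k fuel → 0 < k → k ≤ q → q < k + fuel → firstReturnF rotate i k fuel ≡ q
  firstReturnF-rotate i k zero 0<k k≤q q<k+0 = ⊥-elim (<-irrefl refl (<-≤-trans q<k+0 (≤-trans (≤-reflexive (+-identityʳ k)) k≤q)))
  firstReturnF-rotate i k (suc fuel) 0<k k≤q q<k+1+fuel with fold i rotate k ≟ᶠ i
  ... | yes returned = ≤-antisym k≤q (≮⇒≥ λ k<q → fold-rotate-aperiodic i 0<k k<q returned)
  ... | no moved = firstReturnF-rotate i (suc k) fuel (s≤s z≤n) k<q (subst (q <_) (+-suc k fuel) q<k+1+fuel)
    where
    k<q : k < q
    k<q = ≤∧≢⇒< k≤q (λ { refl → moved (fold-rotate-period i) })

_⊕_ : ∀ {l M} → (Fin l → Fin l) → (Fin M → Fin M) → Fin (l + M) → Fin (l + M)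
_⊕_ {l} {M} f g x = join l M (map⊎ f g (splitAt l x))

data ↑-View (l M : ℕ) : Fin (l + M) → Set where
  left : ∀ i → ↑-View l M (i ↑ˡ M)
  right : ∀ j → ↑-View l M (l ↑ʳ j)

↑-view : ∀ l M x → ↑-View l M x
↑-view l M x with splitAt l x | join-splitAt l M x
... | inj₁ i | refl = left i
... | inj₂ j | refl = right j

module _ {l M : ℕ} (f : Fin l → Fin l) (g : Fin M → Fin M) where

  ⊕-↑ˡ : ∀ i → (f ⊕ g) (i ↑ˡ M) ≡ f i ↑ˡ M
  ⊕-↑ˡ i = cong (join l M ∘ map⊎ f g) (splitAt-↑ˡ l i M)

  ⊕-↑ʳ : ∀ j → (f ⊕ g) (l ↑ʳ j) ≡ l ↑ʳ g j
  ⊕-↑ʳ j = cong (join l M ∘ map⊎ f g) (splitAt-↑ʳ l M j)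

  firstReturnF-⊕-↑ˡ : ∀ i k fuel → firstReturnF (f ⊕ g) (i ↑ˡ M) k fuel ≡ firstReturnF f i k fuel
  firstReturnF-⊕-↑ˡ i k zero = refl
  firstReturnF-⊕-↑ˡ i k (suc fuel) = cong₂ (λ b r → if b then k else r)
    (trans (cong (λ z → ⌊ z ≟ᶠ i ↑ˡ M ⌋) (fold-↑ˡ k)) (≟-injective (_↑ˡ M) (↑ˡ-injective M _ _) _ i))
    (firstReturnF-⊕-↑ˡ i (suc k) fuel)
    where
    fold-↑ˡ : ∀ k → fold (i ↑ˡ M) (f ⊕ g) k ≡ fold i f k ↑ˡ M
    fold-↑ˡ zero = refl
    fold-↑ˡ (suc k) = trans (cong (f ⊕ g) (fold-↑ˡ k)) (⊕-↑ˡ _)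

  firstReturnF-⊕-↑ʳ : ∀ j k fuel → firstReturnF (f ⊕ g) (l ↑ʳ j) k fuel ≡ firstReturnF g j k fuel
  firstReturnF-⊕-↑ʳ j k zero = refl
  firstReturnF-⊕-↑ʳ j k (suc fuel) = cong₂ (λ b r → if b then k else r)
    (trans (cong (λ z → ⌊ z ≟ᶠ l ↑ʳ j ⌋) (fold-↑ʳ k)) (≟-injective (l ↑ʳ_) (↑ʳ-injective l _ _) _ j))
    (firstReturnF-⊕-↑ʳ j (suc k) fuel)
    where
    fold-↑ʳ : ∀ k → fold (l ↑ʳ j) (f ⊕ g) k ≡ l ↑ʳ fold j g k
    fold-↑ʳ zero = refl
    fold-↑ʳ (suc k) = trans (cong (f ⊕ g) (fold-↑ʳ k)) (⊕-↑ʳ _)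

  ⊕-injective : (∀ {a b} → f a ≡ f b → a ≡ b) → (∀ {a b} → g a ≡ g b → a ≡ b) →
                ∀ {x y} → (f ⊕ g) x ≡ (f ⊕ g) y → x ≡ y
  ⊕-injective f-inj g-inj {x} {y} e =
    trans (sym (join-splitAt l M x)) (trans (cong (join l M) (on-parts (splitAt l x) (splitAt l y) parts-eq)) (join-splitAt l M y))
    where
    parts-eq : map⊎ f g (splitAt l x) ≡ map⊎ f g (splitAt l y)
    parts-eq = trans (sym (splitAt-join l M _)) (trans (cong (splitAt l) e) (splitAt-join l M _))
    on-parts : ∀ u v → map⊎ f g u ≡ map⊎ f g v → u ≡ v
    on-parts (inj₁ a) (inj₁ b) fa≡fb = cong inj₁ (f-inj (inj₁-injective fa≡fb))
    on-parts (inj₂ a) (inj₂ b) ga≡gb = cong inj₂ (g-inj (inj₂-injective ga≡gb))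
    on-parts (inj₁ _) (inj₂ _) ()
    on-parts (inj₂ _) (inj₁ _) ()

cycLenF : ∀ {N} → (Fin N → Fin N) → Fin N → ℕ
cycLenF {N} g x = firstReturnF g x 1 N

module _ {l M : ℕ} (f : Fin l → Fin l) (g : Fin M → Fin M) where

  cycLenF-⊕-↑ʳ : ∀ j → cycLenF g j ≢ 0 → cycLenF (f ⊕ g) (l ↑ʳ j) ≡ cycLenF g j
  cycLenF-⊕-↑ʳ j returns = begin
    firstReturnF (f ⊕ g) (l ↑ʳ j) 1 (l + M) ≡⟨ firstReturnF-⊕-↑ʳ f g j 1 (l + M) ⟩
    firstReturnF g j 1 (l + M)               ≡⟨ cong (firstReturnF g j 1) (+-comm l M) ⟩
    firstReturnF g j 1 (M + l)               ≡⟨ firstReturnF-fuel g j 1 M l returns ⟩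
    firstReturnF g j 1 M                     ∎
    where open ≡-Reasoning

cycLenF-rotate-⊕-↑ˡ : ∀ {M} p (g : Fin M → Fin M) i → cycLenF (rotate p ⊕ g) (i ↑ˡ M) ≡ suc p
cycLenF-rotate-⊕-↑ˡ {M} p g i = trans (firstReturnF-⊕-↑ˡ (rotate p) g i 1 (suc p + M))
  (firstReturnF-rotate p i 1 (suc p + M) (s≤s z≤n) (s≤s z≤n) (s≤s (s≤s (m≤m+n p M))))

-- A list ps of natural numbers describes cycles of lengths suc p, p ∈ ps, laid out consecutively.
cyclesSize : List ℕ → ℕ
cyclesSize [] = 0
cyclesSize (p ∷ ps) = suc p + cyclesSize ps

withCycles : ∀ ps → Fin (cyclesSize ps) → Fin (cyclesSize ps)
withCycles [] ()
withCycles (p ∷ ps) = rotate p ⊕ withCycles ps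

withCycles-injective : ∀ ps {x y} → withCycles ps x ≡ withCycles ps y → x ≡ y
withCycles-injective (p ∷ ps) = ⊕-injective (rotate p) (withCycles ps) (rotate-injective p) (withCycles-injective ps)

cycLenF-withCycles-nonzero : ∀ ps x → cycLenF (withCycles ps) x ≢ 0
cycLenF-withCycles-nonzero (p ∷ ps) x with ↑-view (suc p) (cyclesSize ps) x
... | left i = λ e → 0≢1+n (trans (sym e) (cycLenF-rotate-⊕-↑ˡ p (withCycles ps) i))
... | right j = λ e → cycLenF-withCycles-nonzero ps j
                        (trans (sym (cycLenF-⊕-↑ʳ (rotate p) (withCycles ps) j (cycLenF-withCycles-nonzero ps j))) e)

count-cycLenF-withCycles : ∀ ps s →
  ∑[ x ∈ allFin (cyclesSize ps) ] ⟦ cycLenF (withCycles ps) x ≡ᵇ s ⟧ ≡ ∑[ p ∈ ps ] (suc p * ⟦ suc p ≡ᵇ s ⟧)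
count-cycLenF-withCycles [] s = refl
count-cycLenF-withCycles (p ∷ ps) s = trans (∑-allFin-+ (suc p) (cyclesSize ps) _) (cong₂ _+_
  (trans (∑-cong (allFin (suc p)) (λ i → cong (λ z → ⟦ z ≡ᵇ s ⟧) (cycLenF-rotate-⊕-↑ˡ p (withCycles ps) i)))
         (trans (∑-allFin-const (suc p) _) (*-comm _ (suc p))))
  (trans (∑-cong (allFin (cyclesSize ps)) (λ j → cong (λ z → ⟦ z ≡ᵇ s ⟧)
                   (cycLenF-⊕-↑ʳ (rotate p) (withCycles ps) j (cycLenF-withCycles-nonzero ps j))))
         (count-cycLenF-withCycles ps s)))

cyclesSize-++ : ∀ ps qs → cyclesSize (ps ++ qs) ≡ cyclesSize ps + cyclesSize qs
cyclesSize-++ [] qs = refl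
cyclesSize-++ (p ∷ ps) qs = trans (cong (suc p +_) (cyclesSize-++ ps qs)) (sym (+-assoc (suc p) (cyclesSize ps) (cyclesSize qs)))

cyclesSize-replicate : ∀ k p → cyclesSize (replicate k p) ≡ k * suc p
cyclesSize-replicate zero p = refl
cyclesSize-replicate (suc k) p = cong (suc p +_) (cyclesSize-replicate k p)

module _ (a : ℕ → ℕ) where
  open ℕKronecker using () renaming (δ-refl to δℕ-refl; δ-≢ to δℕ-≢)

  -- a r cycles of length r for each r ≤ k, each stored as r − 1
  cycleList : ℕ → List ℕ
  cycleList zero = []
  cycleList (suc r) = cycleList r ++ replicate (a (suc r)) r

  cyclesSize-cycleList : ∀ k → cyclesSize (cycleList k) ≡ weight k a
  cyclesSize-cycleList zero = refl
  cyclesSize-cycleList (suc k) = trans (cyclesSize-++ (cycleList k) _)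
    (cong₂ _+_ (cyclesSize-cycleList k) (trans (cyclesSize-replicate (a (suc k)) k) (*-comm (a (suc k)) (suc k))))

  private
    cycles-of-length : ℕ → ℕ → ℕ
    cycles-of-length k r = ∑[ p ∈ cycleList k ] (suc p * ⟦ suc p ≡ᵇ suc r ⟧)

    cycles-of-length-suc : ∀ k r → cycles-of-length (suc k) r ≡ cycles-of-length k r + a (suc k) * (suc k * ⟦ k ≡ᵇ r ⟧)
    cycles-of-length-suc k r = trans (∑-++ (cycleList k) _ _) (cong (cycles-of-length k r +_) (∑-replicate (a (suc k)) k _))

    cycles-of-length-short : ∀ k r → k ≤ r → cycles-of-length k r ≡ 0
    cycles-of-length-short zero r _ = refl
    cycles-of-length-short (suc k) r k<r = begin
      cycles-of-length (suc k) r
        ≡⟨ cycles-of-length-suc k r ⟩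
      cycles-of-length k r + a (suc k) * (suc k * ⟦ k ≡ᵇ r ⟧)
        ≡⟨ cong₂ (λ u v → u + a (suc k) * (suc k * v)) (cycles-of-length-short k r (<⇒≤ k<r)) (δℕ-≢ (<⇒≢ k<r)) ⟩
      a (suc k) * (suc k * 0)
        ≡⟨ cong (a (suc k) *_) (*-zeroʳ (suc k)) ⟩
      a (suc k) * 0
        ≡⟨ *-zeroʳ (a (suc k)) ⟩
      0 ∎
      where open ≡-Reasoning

  cycles-of-length-cycleList : ∀ k r → r < k → ∑[ p ∈ cycleList k ] (suc p * ⟦ suc p ≡ᵇ suc r ⟧) ≡ suc r * a (suc r)
  cycles-of-length-cycleList (suc k) r (s≤s r≤k) with r ≟ k
  ... | yes refl = begin
    cycles-of-length (suc r) r
      ≡⟨ cycles-of-length-suc r r ⟩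
    cycles-of-length r r + a (suc r) * (suc r * ⟦ r ≡ᵇ r ⟧)
      ≡⟨ cong₂ (λ u v → u + a (suc r) * (suc r * v)) (cycles-of-length-short r r ≤-refl) (δℕ-refl r) ⟩
    a (suc r) * (suc r * 1)
      ≡⟨ cong (a (suc r) *_) (*-identityʳ (suc r)) ⟩
    a (suc r) * suc r
      ≡⟨ *-comm (a (suc r)) (suc r) ⟩
    suc r * a (suc r) ∎
    where open ≡-Reasoning
  ... | no r≢k = begin
    cycles-of-length (suc k) r
      ≡⟨ cycles-of-length-suc k r ⟩
    cycles-of-length k r + a (suc k) * (suc k * ⟦ k ≡ᵇ r ⟧)
      ≡⟨ cong₂ (λ u v → u + a (suc k) * (suc k * v)) (cycles-of-length-cycleList k r (≤∧≢⇒< r≤k r≢k)) (δℕ-≢ (r≢k ∘ sym)) ⟩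
    suc r * a (suc r) + a (suc k) * (suc k * 0)
      ≡⟨ cong (λ v → suc r * a (suc r) + a (suc k) * v) (*-zeroʳ (suc k)) ⟩
    suc r * a (suc r) + a (suc k) * 0
      ≡⟨ cong (suc r * a (suc r) +_) (*-zeroʳ (a (suc k))) ⟩
    suc r * a (suc r) + 0
      ≡⟨ +-identityʳ _ ⟩
    suc r * a (suc r) ∎
    where open ≡-Reasoning

  cycleType-realised : ∀ n → weight n a ≡ n → Σ (Vec (Fin n) n) λ ω → isPerm ω ≡ true × hasCycleType a ω ≡ true
  cycleType-realised n weight≡n = subst Realised N≡n (ω , injective⇒isPerm ω ω-injective , ω-type)
    where
    Realised : ℕ → Set
    Realised K = Σ (Vec (Fin K) K) λ ω → isPerm ω ≡ true × hasCycleType a ω ≡ true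
    ps : List ℕ
    ps = cycleList n
    N : ℕ
    N = cyclesSize ps
    N≡n : N ≡ n
    N≡n = trans (cyclesSize-cycleList n) weight≡n
    ω : Vec (Fin N) N
    ω = tabulate (withCycles ps)
    ω-injective : IsInjective ω
    ω-injective {x} {y} e = withCycles-injective ps
      (trans (sym (lookup∘tabulate (withCycles ps) x)) (trans e (lookup∘tabulate (withCycles ps) y)))
    count-ok : ∀ r → r < N → count (λ x → cycLen ω x ≡ᵇ suc r) (allFin N) ≡ suc r * a (suc r)
    count-ok r r<N = begin
      count (λ x → cycLen ω x ≡ᵇ suc r) (allFin N)
        ≡⟨ count≡∑ _ (allFin N) ⟩
      ∑[ x ∈ allFin N ] ⟦ cycLen ω x ≡ᵇ suc r ⟧
        ≡⟨ ∑-cong (allFin N) (λ x → cong (λ z → ⟦ z ≡ᵇ suc r ⟧) (firstReturn-tabulate (withCycles ps) x 1 N)) ⟩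
      ∑[ x ∈ allFin N ] ⟦ cycLenF (withCycles ps) x ≡ᵇ suc r ⟧
        ≡⟨ count-cycLenF-withCycles ps (suc r) ⟩
      ∑[ p ∈ ps ] (suc p * ⟦ suc p ≡ᵇ suc r ⟧)
        ≡⟨ cycles-of-length-cycleList n r (subst (r <_) N≡n r<N) ⟩
      suc r * a (suc r) ∎
      where open ≡-Reasoning
    ω-type : hasCycleType a ω ≡ true
    ω-type = all-intro (upTo N) λ {r} r∈ →
      subst (λ z → (z ≡ᵇ suc r * a (suc r)) ≡ true) (sym (count-ok r (∈-upTo⁻ r∈))) (≡ᵇ-refl (suc r * a (suc r)))
      where
      ≡ᵇ-refl : ∀ m → (m ≡ᵇ m) ≡ true
      ≡ᵇ-refl zero = refl
      ≡ᵇ-refl (suc m) = ≡ᵇ-refl m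

-- The probability as a fraction

module _ where
  private
    frac≃ : ∀ p b → toℚᵘ (frac p (suc b)) ℚᵘ.≃ mkℚᵘ p b
    frac≃ p b = ℚ.toℚᵘ-fromℚᵘ (mkℚᵘ p b)

  frac-cross : ∀ p q b d → p ℤ.* ℤ.+ suc d ≡ q ℤ.* ℤ.+ suc b → frac p (suc b) ≡ frac q (suc d)
  frac-cross p q b d e = ℚ.toℚᵘ-injective (ℚᵘ.≃-trans (frac≃ p b) (ℚᵘ.≃-trans (*≡* e) (ℚᵘ.≃-sym (frac≃ q d))))

  frac-* : ∀ p q b d → frac p (suc b) ℚ.* frac q (suc d) ≡ frac (p ℤ.* q) (suc b * suc d)
  frac-* p q b d = ℚ.toℚᵘ-injective (ℚᵘ.≃-trans (ℚ.toℚᵘ-homo-* (frac p (suc b)) (frac q (suc d)))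
    (ℚᵘ.≃-trans (ℚᵘ.*-cong (frac≃ p b) (frac≃ q d)) (ℚᵘ.≃-sym (frac≃ _ _))))

  frac-+ : ∀ p q b d → frac p (suc b) ℚ.+ frac q (suc d) ≡ frac (p ℤ.* ℤ.+ suc d ℤ.+ q ℤ.* ℤ.+ suc b) (suc b * suc d)
  frac-+ p q b d = ℚ.toℚᵘ-injective (ℚᵘ.≃-trans (ℚ.toℚᵘ-homo-+ (frac p (suc b)) (frac q (suc d)))
    (ℚᵘ.≃-trans (ℚᵘ.+-cong (frac≃ p b) (frac≃ q d)) (ℚᵘ.≃-sym (frac≃ _ _))))

  frac-neg : ∀ p b → ℚ.- frac p (suc b) ≡ frac (ℤ.- p) (suc b)
  frac-neg p b = ℚ.toℚᵘ-injective (ℚᵘ.≃-trans (ℚ.toℚᵘ-homo‿- (frac p (suc b)))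
    (ℚᵘ.≃-trans (ℚᵘ.-‿cong (frac≃ p b)) (ℚᵘ.≃-sym (frac≃ _ _))))

  frac-+-common : ∀ p q b → frac p (suc b) ℚ.+ frac q (suc b) ≡ frac (p ℤ.+ q) (suc b)
  frac-+-common p q b = trans (frac-+ p q b b) (frac-cross (p ℤ.* ℤ.+ suc b ℤ.+ q ℤ.* ℤ.+ suc b) (p ℤ.+ q) (b + b * suc b) b (begin
    (p ℤ.* ℤ.+ suc b ℤ.+ q ℤ.* ℤ.+ suc b) ℤ.* ℤ.+ suc b   ≡⟨ regroup p q (ℤ.+ suc b) ⟩
    (p ℤ.+ q) ℤ.* (ℤ.+ suc b ℤ.* ℤ.+ suc b)             ≡⟨ cong ((p ℤ.+ q) ℤ.*_) (ℤ.pos-* (suc b) (suc b)) ⟨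
    (p ℤ.+ q) ℤ.* ℤ.+ (suc b * suc b)                 ∎))
    where
    open ≡-Reasoning
    regroup : ∀ p q s → (p ℤ.* s ℤ.+ q ℤ.* s) ℤ.* s ≡ (p ℤ.+ q) ℤ.* (s ℤ.* s)
    regroup = solve-∀ᶻ

  frac-−-common : ∀ p q b → frac p (suc b) ℚ.- frac q (suc b) ≡ frac (p ℤ.- q) (suc b)
  frac-−-common p q b = trans (cong (frac p (suc b) ℚ.+_) (frac-neg q b)) (frac-+-common p (ℤ.- q) b)

module _ (x y : ℕ) {X Y : ℤ} (x≡X : ℤ.+ x ≡ X) (y≡Y : ℤ.+ y ≡ Y) where

  +-lift : ℤ.+ (x + y) ≡ X ℤ.+ Y
  +-lift = trans (ℤ.pos-+ x y) (cong₂ ℤ._+_ x≡X y≡Y)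

  *-lift : ℤ.+ (x * y) ≡ X ℤ.* Y
  *-lift = trans (ℤ.pos-* x y) (cong₂ ℤ._*_ x≡X y≡Y)

≡-lift : ∀ {x y : ℕ} {X Y : ℤ} → ℤ.+ x ≡ X → ℤ.+ y ≡ Y → x ≡ y → X ≡ Y
≡-lift x≡X y≡Y refl = trans (sym x≡X) y≡Y

-- Denominators cleared, with P = n(n−1), N₂ = n−2, A₁₁ = a₁(a₁−1), A₂₂ = 2a₂ and C = |C_λ|.
module _ (T₀ α β P A₁₁ A₂₂ C : ℤ) where
  open ≡-Reasoning

  adjacent-inversions-cleared : T₀ ℤ.+ T₀ ℤ.+ α ≡ C ℤ.+ β → α ℤ.* P ≡ A₁₁ ℤ.* C → β ℤ.* P ≡ A₂₂ ℤ.* C →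
                                ℤ.+ 2 ℤ.* T₀ ℤ.* P ≡ (P ℤ.+ A₂₂ ℤ.- A₁₁) ℤ.* C
  adjacent-inversions-cleared adjacent fixed swapped = begin
    ℤ.+ 2 ℤ.* T₀ ℤ.* P                      ≡⟨ isolate T₀ α P ⟩
    (T₀ ℤ.+ T₀ ℤ.+ α) ℤ.* P ℤ.- α ℤ.* P     ≡⟨ cong₂ (λ u v → u ℤ.* P ℤ.- v) adjacent fixed ⟩
    (C ℤ.+ β) ℤ.* P ℤ.- A₁₁ ℤ.* C           ≡⟨ distribute C β P (A₁₁ ℤ.* C) ⟩
    C ℤ.* P ℤ.+ β ℤ.* P ℤ.- A₁₁ ℤ.* C       ≡⟨ cong (λ u → C ℤ.* P ℤ.+ u ℤ.- A₁₁ ℤ.* C) swapped ⟩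
    C ℤ.* P ℤ.+ A₂₂ ℤ.* C ℤ.- A₁₁ ℤ.* C     ≡⟨ collect C P A₂₂ A₁₁ ⟩
    (P ℤ.+ A₂₂ ℤ.- A₁₁) ℤ.* C               ∎
    where
    isolate : ∀ T₀ α P → ℤ.+ 2 ℤ.* T₀ ℤ.* P ≡ (T₀ ℤ.+ T₀ ℤ.+ α) ℤ.* P ℤ.- α ℤ.* P
    isolate = solve-∀ᶻ
    distribute : ∀ C β P Z → (C ℤ.+ β) ℤ.* P ℤ.- Z ≡ C ℤ.* P ℤ.+ β ℤ.* P ℤ.- Z
    distribute = solve-∀ᶻ
    collect : ∀ C P A₂₂ A₁₁ → C ℤ.* P ℤ.+ A₂₂ ℤ.* C ℤ.- A₁₁ ℤ.* C ≡ (P ℤ.+ A₂₂ ℤ.- A₁₁) ℤ.* C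
    collect = solve-∀ᶻ

module _ (ξ ψ M N NA₁ A₁ A₁A₁ A₂₂ C : ℤ) where
  open ≡-Reasoning

  path-minus-mapFix-cleared : ξ ℤ.* M ℤ.+ A₁A₁ ℤ.* C ≡ NA₁ ℤ.* C → ψ ℤ.* M ℤ.+ A₁ ℤ.* C ℤ.+ A₂₂ ℤ.* C ≡ N ℤ.* C →
                              (ψ ℤ.- ξ) ℤ.* M ≡ (N ℤ.- NA₁ ℤ.- A₁ ℤ.+ A₁A₁ ℤ.- A₂₂) ℤ.* C
  path-minus-mapFix-cleared mapFix path = begin
    (ψ ℤ.- ξ) ℤ.* M
      ≡⟨ isolate ξ ψ M A₁ A₁A₁ A₂₂ C ⟩
    (ψ ℤ.* M ℤ.+ A₁ ℤ.* C ℤ.+ A₂₂ ℤ.* C) ℤ.- (ξ ℤ.* M ℤ.+ A₁A₁ ℤ.* C) ℤ.- A₁ ℤ.* C ℤ.- A₂₂ ℤ.* C ℤ.+ A₁A₁ ℤ.* C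
      ≡⟨ cong₂ (λ u v → u ℤ.- v ℤ.- A₁ ℤ.* C ℤ.- A₂₂ ℤ.* C ℤ.+ A₁A₁ ℤ.* C) path mapFix ⟩
    N ℤ.* C ℤ.- NA₁ ℤ.* C ℤ.- A₁ ℤ.* C ℤ.- A₂₂ ℤ.* C ℤ.+ A₁A₁ ℤ.* C
      ≡⟨ collect N NA₁ A₁ A₁A₁ A₂₂ C ⟩
    (N ℤ.- NA₁ ℤ.- A₁ ℤ.+ A₁A₁ ℤ.- A₂₂) ℤ.* C ∎
    where
    isolate : ∀ ξ ψ M A₁ A₁A₁ A₂₂ C → (ψ ℤ.- ξ) ℤ.* M ≡
      (ψ ℤ.* M ℤ.+ A₁ ℤ.* C ℤ.+ A₂₂ ℤ.* C) ℤ.- (ξ ℤ.* M ℤ.+ A₁A₁ ℤ.* C) ℤ.- A₁ ℤ.* C ℤ.- A₂₂ ℤ.* C ℤ.+ A₁A₁ ℤ.* C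
    isolate = solve-∀ᶻ
    collect : ∀ N NA₁ A₁ A₁A₁ A₂₂ C → N ℤ.* C ℤ.- NA₁ ℤ.* C ℤ.- A₁ ℤ.* C ℤ.- A₂₂ ℤ.* C ℤ.+ A₁A₁ ℤ.* C ≡
      (N ℤ.- NA₁ ℤ.- A₁ ℤ.+ A₁A₁ ℤ.- A₂₂) ℤ.* C
    collect = solve-∀ᶻ

module _ (T T₀ D ξ ψ P N₂ A₁₁ A₂₂ X C : ℤ) where
  open ≡-Reasoning

  inversions-cleared : T ℤ.+ D ℤ.* ξ ≡ T₀ ℤ.+ D ℤ.* ψ →
    ℤ.+ 2 ℤ.* T₀ ℤ.* P ≡ (P ℤ.+ A₂₂ ℤ.- A₁₁) ℤ.* C → (ψ ℤ.- ξ) ℤ.* (P ℤ.* N₂) ≡ X ℤ.* C →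
    ℤ.+ 2 ℤ.* (P ℤ.* N₂) ℤ.* T ≡ (P ℤ.* N₂ ℤ.+ N₂ ℤ.* A₂₂ ℤ.- N₂ ℤ.* A₁₁ ℤ.+ ℤ.+ 2 ℤ.* D ℤ.* X) ℤ.* C
  inversions-cleared shift adjacent difference = begin
    ℤ.+ 2 ℤ.* (P ℤ.* N₂) ℤ.* T
      ≡⟨ isolate T D ξ P N₂ ⟩
    ℤ.+ 2 ℤ.* (P ℤ.* N₂) ℤ.* (T ℤ.+ D ℤ.* ξ) ℤ.- ℤ.+ 2 ℤ.* D ℤ.* ξ ℤ.* (P ℤ.* N₂)
      ≡⟨ cong (λ u → ℤ.+ 2 ℤ.* (P ℤ.* N₂) ℤ.* u ℤ.- ℤ.+ 2 ℤ.* D ℤ.* ξ ℤ.* (P ℤ.* N₂)) shift ⟩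
    ℤ.+ 2 ℤ.* (P ℤ.* N₂) ℤ.* (T₀ ℤ.+ D ℤ.* ψ) ℤ.- ℤ.+ 2 ℤ.* D ℤ.* ξ ℤ.* (P ℤ.* N₂)
      ≡⟨ regroup T₀ D ξ ψ P N₂ ⟩
    N₂ ℤ.* (ℤ.+ 2 ℤ.* T₀ ℤ.* P) ℤ.+ ℤ.+ 2 ℤ.* D ℤ.* ((ψ ℤ.- ξ) ℤ.* (P ℤ.* N₂))
      ≡⟨ cong₂ (λ u v → N₂ ℤ.* u ℤ.+ ℤ.+ 2 ℤ.* D ℤ.* v) adjacent difference ⟩
    N₂ ℤ.* ((P ℤ.+ A₂₂ ℤ.- A₁₁) ℤ.* C) ℤ.+ ℤ.+ 2 ℤ.* D ℤ.* (X ℤ.* C)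
      ≡⟨ collect D P N₂ A₁₁ A₂₂ X C ⟩
    (P ℤ.* N₂ ℤ.+ N₂ ℤ.* A₂₂ ℤ.- N₂ ℤ.* A₁₁ ℤ.+ ℤ.+ 2 ℤ.* D ℤ.* X) ℤ.* C ∎
    where
    isolate : ∀ T D ξ P N₂ → ℤ.+ 2 ℤ.* (P ℤ.* N₂) ℤ.* T ≡
      ℤ.+ 2 ℤ.* (P ℤ.* N₂) ℤ.* (T ℤ.+ D ℤ.* ξ) ℤ.- ℤ.+ 2 ℤ.* D ℤ.* ξ ℤ.* (P ℤ.* N₂)
    isolate = solve-∀ᶻ
    regroup : ∀ T₀ D ξ ψ P N₂ → ℤ.+ 2 ℤ.* (P ℤ.* N₂) ℤ.* (T₀ ℤ.+ D ℤ.* ψ) ℤ.- ℤ.+ 2 ℤ.* D ℤ.* ξ ℤ.* (P ℤ.* N₂) ≡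
      N₂ ℤ.* (ℤ.+ 2 ℤ.* T₀ ℤ.* P) ℤ.+ ℤ.+ 2 ℤ.* D ℤ.* ((ψ ℤ.- ξ) ℤ.* (P ℤ.* N₂))
    regroup = solve-∀ᶻ
    collect : ∀ D P N₂ A₁₁ A₂₂ X C → N₂ ℤ.* ((P ℤ.+ A₂₂ ℤ.- A₁₁) ℤ.* C) ℤ.+ ℤ.+ 2 ℤ.* D ℤ.* (X ℤ.* C) ≡
      (P ℤ.* N₂ ℤ.+ N₂ ℤ.* A₂₂ ℤ.- N₂ ℤ.* A₁₁ ℤ.+ ℤ.+ 2 ℤ.* D ℤ.* X) ℤ.* C
    collect = solve-∀ᶻ

frac-crossℕ : ∀ p q b d → p * suc d ≡ q * suc b → frac (ℤ.+ p) (suc b) ≡ frac (ℤ.+ q) (suc d)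
frac-crossℕ p q b d e = frac-cross (ℤ.+ p) (ℤ.+ q) b d (trans (sym (ℤ.pos-* p (suc d))) (trans (cong ℤ.+_ e) (ℤ.pos-* q (suc b))))

module _ (m a₁ a₂ d : ℕ) where
  open ≡-Reasoning
  private
    n s₂ s₁ : ℕ
    n = suc (suc (suc m))
    s₂ = suc (suc m)
    s₁ = suc m
    N₃ : ℕ
    N₃ = n * s₂ * s₁
    X : ℤ
    X = ℤ.+ n ℤ.- ℤ.+ (n * a₁) ℤ.- ℤ.+ a₁ ℤ.+ ℤ.+ (a₁ * a₁) ℤ.- ℤ.+ (2 * a₂)

  probability-formula : ℚ
  probability-formula =
    frac (ℤ.+ 1) 2
    ℚ.+ frac (ℤ.+ a₂) (n * (n ∸ 1))
    ℚ.- frac (ℤ.+ (a₁ * (a₁ ∸ 1))) (2 * n * (n ∸ 1))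
    ℚ.+ frac (ℤ.+ d) 1 ℚ.* frac X (n * (n ∸ 1) * (n ∸ 2))

  probability-common-denominator :
    probability-formula ≡ frac (ℤ.+ N₃ ℤ.+ ℤ.+ (s₁ * (2 * a₂)) ℤ.- ℤ.+ (s₁ * (a₁ * (a₁ ∸ 1))) ℤ.+ ℤ.+ 2 ℤ.* ℤ.+ d ℤ.* X) (2 * N₃)
  probability-common-denominator = begin
    frac (ℤ.+ 1) 2 ℚ.+ frac (ℤ.+ a₂) (n * s₂) ℚ.- frac (ℤ.+ (a₁ * (a₁ ∸ 1))) (2 * n * s₂) ℚ.+ frac (ℤ.+ d) 1 ℚ.* frac X N₃
      ≡⟨ cong₂ ℚ._+_ (cong₂ ℚ._-_ (cong₂ ℚ._+_ half pairs) fixed-pairs) (trans (frac-* (ℤ.+ d) X 0 _) paths) ⟩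
    frac (ℤ.+ N₃) (2 * N₃) ℚ.+ frac (ℤ.+ (s₁ * (2 * a₂))) (2 * N₃) ℚ.- frac (ℤ.+ (s₁ * (a₁ * (a₁ ∸ 1)))) (2 * N₃)
      ℚ.+ frac (ℤ.+ 2 ℤ.* ℤ.+ d ℤ.* X) (2 * N₃)
      ≡⟨ cong (λ z → z ℚ.- frac (ℤ.+ (s₁ * (a₁ * (a₁ ∸ 1)))) (2 * N₃) ℚ.+ frac (ℤ.+ 2 ℤ.* ℤ.+ d ℤ.* X) (2 * N₃))
              (frac-+-common (ℤ.+ N₃) (ℤ.+ (s₁ * (2 * a₂))) _) ⟩
    frac (ℤ.+ N₃ ℤ.+ ℤ.+ (s₁ * (2 * a₂))) (2 * N₃) ℚ.- frac (ℤ.+ (s₁ * (a₁ * (a₁ ∸ 1)))) (2 * N₃)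
      ℚ.+ frac (ℤ.+ 2 ℤ.* ℤ.+ d ℤ.* X) (2 * N₃)
      ≡⟨ cong (ℚ._+ frac (ℤ.+ 2 ℤ.* ℤ.+ d ℤ.* X) (2 * N₃)) (frac-−-common (ℤ.+ N₃ ℤ.+ ℤ.+ (s₁ * (2 * a₂))) (ℤ.+ (s₁ * (a₁ * (a₁ ∸ 1)))) _) ⟩
    frac (ℤ.+ N₃ ℤ.+ ℤ.+ (s₁ * (2 * a₂)) ℤ.- ℤ.+ (s₁ * (a₁ * (a₁ ∸ 1)))) (2 * N₃) ℚ.+ frac (ℤ.+ 2 ℤ.* ℤ.+ d ℤ.* X) (2 * N₃)
      ≡⟨ frac-+-common (ℤ.+ N₃ ℤ.+ ℤ.+ (s₁ * (2 * a₂)) ℤ.- ℤ.+ (s₁ * (a₁ * (a₁ ∸ 1)))) (ℤ.+ 2 ℤ.* ℤ.+ d ℤ.* X) _ ⟩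
    frac (ℤ.+ N₃ ℤ.+ ℤ.+ (s₁ * (2 * a₂)) ℤ.- ℤ.+ (s₁ * (a₁ * (a₁ ∸ 1))) ℤ.+ ℤ.+ 2 ℤ.* ℤ.+ d ℤ.* X) (2 * N₃) ∎
    where
    half : frac (ℤ.+ 1) 2 ≡ frac (ℤ.+ N₃) (2 * N₃)
    half = frac-crossℕ 1 N₃ 1 _ (cross N₃)
      where
      cross : ∀ N → 1 * (2 * N) ≡ N * 2
      cross = solve-∀
    pairs : frac (ℤ.+ a₂) (n * s₂) ≡ frac (ℤ.+ (s₁ * (2 * a₂))) (2 * N₃)
    pairs = frac-crossℕ a₂ (s₁ * (2 * a₂)) _ _ (cross a₂ (n * s₂) s₁)
      where
      cross : ∀ a P s → a * (2 * (P * s)) ≡ s * (2 * a) * P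
      cross = solve-∀
    fixed-pairs : frac (ℤ.+ (a₁ * (a₁ ∸ 1))) (2 * n * s₂) ≡ frac (ℤ.+ (s₁ * (a₁ * (a₁ ∸ 1)))) (2 * N₃)
    fixed-pairs = frac-crossℕ (a₁ * (a₁ ∸ 1)) (s₁ * (a₁ * (a₁ ∸ 1))) _ _ (cross (a₁ * (a₁ ∸ 1)) n s₂ s₁)
      where
      cross : ∀ A n s₂ s₁ → A * (2 * (n * s₂ * s₁)) ≡ s₁ * A * (2 * n * s₂)
      cross = solve-∀
    paths : frac (ℤ.+ d ℤ.* X) (1 * N₃) ≡ frac (ℤ.+ 2 ℤ.* ℤ.+ d ℤ.* X) (2 * N₃)
    paths = frac-cross (ℤ.+ d ℤ.* X) (ℤ.+ 2 ℤ.* ℤ.+ d ℤ.* X) _ _ (begin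
      ℤ.+ d ℤ.* X ℤ.* ℤ.+ (2 * N₃)                  ≡⟨ cong (ℤ.+ d ℤ.* X ℤ.*_) (ℤ.pos-* 2 N₃) ⟩
      ℤ.+ d ℤ.* X ℤ.* (ℤ.+ 2 ℤ.* ℤ.+ N₃)           ≡⟨ cross (ℤ.+ d) X (ℤ.+ N₃) ⟩
      ℤ.+ 2 ℤ.* ℤ.+ d ℤ.* X ℤ.* (ℤ.+ 1 ℤ.* ℤ.+ N₃) ≡⟨ cong (ℤ.+ 2 ℤ.* ℤ.+ d ℤ.* X ℤ.*_) (ℤ.pos-* 1 N₃) ⟨
      ℤ.+ 2 ℤ.* ℤ.+ d ℤ.* X ℤ.* ℤ.+ (1 * N₃)       ∎)
      where
      cross : ∀ D X N → D ℤ.* X ℤ.* (ℤ.+ 2 ℤ.* N) ≡ ℤ.+ 2 ℤ.* D ℤ.* X ℤ.* (ℤ.+ 1 ℤ.* N)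
      cross = solve-∀ᶻ

module _ (n s₂ s₁ a₁ a₂ d T T₀ c fix swap mapFix path : ℕ) where
  private
    N₂ A₁₁ A₂₂ C : ℤ
    N₂ = ℤ.+ s₁
    A₁₁ = ℤ.+ (a₁ * (a₁ ∸ 1))
    A₂₂ = ℤ.+ (2 * a₂)
    C = ℤ.+ c
    P : ℤ
    P = ℤ.+ (n * s₂)

  counts⇒cleared :
    T₀ + T₀ + fix ≡ c + swap → T + d * mapFix ≡ T₀ + d * path →
    fix * (n * s₂) ≡ a₁ * (a₁ ∸ 1) * c → swap * (n * s₂) ≡ 2 * a₂ * c →
    mapFix * (n * s₂ * s₁) + a₁ * a₁ * c ≡ n * a₁ * c → path * (n * s₂ * s₁) + a₁ * c + 2 * a₂ * c ≡ n * c →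
    ℤ.+ 2 ℤ.* (P ℤ.* N₂) ℤ.* ℤ.+ T ≡
    (P ℤ.* N₂ ℤ.+ N₂ ℤ.* A₂₂ ℤ.- N₂ ℤ.* A₁₁
      ℤ.+ ℤ.+ 2 ℤ.* ℤ.+ d ℤ.* (ℤ.+ n ℤ.- ℤ.+ (n * a₁) ℤ.- ℤ.+ a₁ ℤ.+ ℤ.+ (a₁ * a₁) ℤ.- ℤ.+ (2 * a₂))) ℤ.* C
  counts⇒cleared adjacent shift fixed swapped mapFixed paths =
    inversions-cleared (ℤ.+ T) (ℤ.+ T₀) (ℤ.+ d) (ℤ.+ mapFix) (ℤ.+ path) P N₂ A₁₁ A₂₂ _ C
      (≡-lift (+-lift T (d * mapFix) refl (*-lift d mapFix refl refl)) (+-lift T₀ (d * path) refl (*-lift d path refl refl)) shift)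
      (adjacent-inversions-cleared (ℤ.+ T₀) (ℤ.+ fix) (ℤ.+ swap) P A₁₁ A₂₂ C
        (≡-lift (+-lift (T₀ + T₀) fix (+-lift T₀ T₀ refl refl) refl) (+-lift c swap refl refl) adjacent)
        (≡-lift (*-lift fix (n * s₂) refl refl) (*-lift (a₁ * (a₁ ∸ 1)) c refl refl) fixed)
        (≡-lift (*-lift swap (n * s₂) refl refl) (*-lift (2 * a₂) c refl refl) swapped))
      (trans (cong ((ℤ.+ path ℤ.- ℤ.+ mapFix) ℤ.*_) (sym (ℤ.pos-* (n * s₂) s₁)))
        (path-minus-mapFix-cleared (ℤ.+ mapFix) (ℤ.+ path) (ℤ.+ M) (ℤ.+ n) (ℤ.+ (n * a₁)) (ℤ.+ a₁) (ℤ.+ (a₁ * a₁)) A₂₂ C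
          (≡-lift (+-lift (mapFix * M) (a₁ * a₁ * c) (*-lift mapFix M refl refl) (*-lift (a₁ * a₁) c refl refl))
                  (*-lift (n * a₁) c refl refl) mapFixed)
          (≡-lift (+-lift (path * M + a₁ * c) (2 * a₂ * c)
                    (+-lift (path * M) (a₁ * c) (*-lift path M refl refl) (*-lift a₁ c refl refl)) (*-lift (2 * a₂) c refl refl))
                  (*-lift n c refl refl) paths)))
    where
    M : ℕ
    M = n * s₂ * s₁

module Probability (m : ℕ) (a : ℕ → ℕ) (weight≡n : weight (suc (suc (suc m))) a ≡ suc (suc (suc m))) where
  open PatternCounts m a
  open InversionCounts m a
  open ≡-Reasoning

  class-size-suc : ∃ λ c′ → class-size ≡ suc c′
  class-size-suc with cycleType-realised a n weight≡n
  ... | ω , perm , type with class-size | ∑ᶜ-positive ω perm type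
  ...   | suc c′ | _ = c′ , refl

  inversion-fraction : ∀ c′ → class-size ≡ suc c′ → ∀ (i j : Fin n) → toℕ i < toℕ j →
    frac (ℤ.+ inversions i j) (suc c′) ≡ probability-formula m (a 1) (a 2) (toℕ j ∸ toℕ i ∸ 1)
  inversion-fraction c′ size≡1+c′ i j i<j = begin
    frac (ℤ.+ inversions i j) (suc c′)  ≡⟨ frac-cross (ℤ.+ inversions i j) K′ c′ _ cleared ⟩
    frac K′ (2 * (n * s₂ * s₁))         ≡⟨ probability-common-denominator m (a 1) (a 2) d ⟨
    probability-formula m (a 1) (a 2) d ∎
    where
    s₂ s₁ d : ℕ
    s₂ = suc (suc m)
    s₁ = suc m
    d = toℕ j ∸ toℕ i ∸ 1
    X : ℤ
    X = ℤ.+ n ℤ.- ℤ.+ (n * a 1) ℤ.- ℤ.+ a 1 ℤ.+ ℤ.+ (a 1 * a 1) ℤ.- ℤ.+ (2 * a 2)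
    K′ : ℤ
    K′ = ℤ.+ (n * s₂ * s₁) ℤ.+ ℤ.+ (s₁ * (2 * a 2)) ℤ.- ℤ.+ (s₁ * (a 1 * (a 1 ∸ 1))) ℤ.+ ℤ.+ 2 ℤ.* ℤ.+ d ℤ.* X
    i⁺<n : suc (toℕ i) < n
    i⁺<n = ≤-trans (s≤s i<j) (toℕ<n j)
    i⁺ : Fin n
    i⁺ = fromℕ< i⁺<n
    j≡i⁺+d : toℕ j ≡ toℕ i⁺ + d
    j≡i⁺+d = begin
      toℕ j                               ≡⟨ m+[n∸m]≡n i<j ⟨
      suc (toℕ i) + (toℕ j ∸ suc (toℕ i))
        ≡⟨ cong₂ _+_ (sym (toℕ-fromℕ< i⁺<n)) (trans (cong (toℕ j ∸_) (+-comm 1 (toℕ i))) (sym (∸-+-assoc (toℕ j) (toℕ i) 1))) ⟩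
      toℕ i⁺ + d ∎
    numerator : ℤ.+ (n * s₂) ℤ.* ℤ.+ s₁ ℤ.+ ℤ.+ s₁ ℤ.* ℤ.+ (2 * a 2) ℤ.- ℤ.+ s₁ ℤ.* ℤ.+ (a 1 * (a 1 ∸ 1)) ℤ.+ ℤ.+ 2 ℤ.* ℤ.+ d ℤ.* X ≡ K′
    numerator = cong (ℤ._+ ℤ.+ 2 ℤ.* ℤ.+ d ℤ.* X)
      (cong₂ ℤ._-_ (cong₂ ℤ._+_ (sym (ℤ.pos-* (n * s₂) s₁)) (sym (ℤ.pos-* s₁ (2 * a 2)))) (sym (ℤ.pos-* s₁ (a 1 * (a 1 ∸ 1)))))
    i≢i⁺ : i ≢ i⁺
    i≢i⁺ e = 1+n≢n (trans (sym (toℕ-fromℕ< i⁺<n)) (cong toℕ (sym e)))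
    adjacent : inversions i i⁺ + inversions i i⁺ + fix² ≡ class-size + swap²
    adjacent = begin
      inversions i i⁺ + inversions i i⁺ + fix²                    ≡⟨ cong (inversions i i⁺ + inversions i i⁺ +_) (fix²-const i≢i⁺) ⟨
      inversions i i⁺ + inversions i i⁺ + #[ i ↦ i , i⁺ ↦ i⁺ ]    ≡⟨ inversions-adjacent (toℕ-fromℕ< i⁺<n) ⟩
      class-size + #[ i ↦ i⁺ , i⁺ ↦ i ]                          ≡⟨ cong (class-size +_) (swap²-const i≢i⁺) ⟩
      class-size + swap²                                          ∎
    cleared : ℤ.+ inversions i j ℤ.* ℤ.+ (2 * (n * s₂ * s₁)) ≡ K′ ℤ.* ℤ.+ suc c′
    cleared = begin
      ℤ.+ inversions i j ℤ.* ℤ.+ (2 * (n * s₂ * s₁))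
        ≡⟨ trans (ℤ.*-comm (ℤ.+ inversions i j) (ℤ.+ (2 * (n * s₂ * s₁))))
                 (cong (ℤ._* ℤ.+ inversions i j) (*-lift 2 (n * s₂ * s₁) refl (ℤ.pos-* (n * s₂) s₁))) ⟩
      ℤ.+ 2 ℤ.* (ℤ.+ (n * s₂) ℤ.* ℤ.+ s₁) ℤ.* ℤ.+ inversions i j
        ≡⟨ counts⇒cleared n s₂ s₁ (a 1) (a 2) d (inversions i j) (inversions i i⁺) class-size fix² swap² mapFix³ path³
             adjacent (inversions-shift (toℕ-fromℕ< i⁺<n) d j≡i⁺+d) fix²-count swap²-count mapFix³-count path³-count ⟩
      (ℤ.+ (n * s₂) ℤ.* ℤ.+ s₁ ℤ.+ ℤ.+ s₁ ℤ.* ℤ.+ (2 * a 2) ℤ.- ℤ.+ s₁ ℤ.* ℤ.+ (a 1 * (a 1 ∸ 1)) ℤ.+ ℤ.+ 2 ℤ.* ℤ.+ d ℤ.* X) ℤ.* ℤ.+ class-size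
        ≡⟨ cong₂ ℤ._*_ numerator (cong ℤ.+_ size≡1+c′) ⟩
      K′ ℤ.* ℤ.+ suc c′ ∎

  PrI-formula : ∀ (i j : Fin n) → toℕ i < toℕ j → PrI n a i j ≡ probability-formula m (a 1) (a 2) (toℕ j ∸ toℕ i ∸ 1)
  PrI-formula i j i<j = begin
    PrI n a i j
      ≡⟨ cong₂ (λ u v → frac (ℤ.+ u) v) (count-Class (I i j)) (trans length-Class size≡) ⟩
    frac (ℤ.+ inversions i j) (suc c′)
      ≡⟨ inversion-fraction c′ size≡ i j i<j ⟩
    probability-formula m (a 1) (a 2) (toℕ j ∸ toℕ i ∸ 1) ∎
    where
    c′ : ℕ
    c′ = proj₁ class-size-suc
    size≡ : class-size ≡ suc c′
    size≡ = proj₂ class-size-suc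

lemma4p7 : (n : ℕ) → 3 ≤ n → (a : ℕ → ℕ) → weight n a ≡ n →
  (i j : Fin n) → i <ᶠ j →
  PrI n a i j ≡
    frac (ℤ.+ 1) 2
    ℚ.+ frac (ℤ.+ a 2) (n * (n ∸ 1))
    ℚ.- frac (ℤ.+ (a 1 * (a 1 ∸ 1))) (2 * n * (n ∸ 1))
    ℚ.+ frac (ℤ.+ (toℕ j ∸ toℕ i ∸ 1)) 1
      ℚ.* frac (ℤ.+ n ℤ.- ℤ.+ (n * a 1) ℤ.- ℤ.+ a 1 ℤ.+ ℤ.+ (a 1 * a 1) ℤ.- ℤ.+ (2 * a 2))
             (n * (n ∸ 1) * (n ∸ 2))
lemma4p7 (suc (suc (suc m))) (s≤s (s≤s (s≤s z≤n))) a weight≡n i j i<j = Probability.PrI-formula m a weight≡n i j i<j
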